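{- Let $q$ be an indeterminate. For integers $k,m\ge 0$ let $a_{k,m}=h_{2m-k}(\{1,q\}^{k-m+1})$, i.e. $a_{k,m}=\sum_{i=0}^{2m-k}\binom{k-m+i}{k-m}\binom{m-i}{k-m}q^i$ for $m\le k$ and $a_{k,m}=0$ for $m>k$. Then for every integer $n\ge 0$ the inverse of the lower triangular matrix $\left(a_{k,m}\right)_{k,m\in\{0,\dots,n\}}$ is the lower triangular matrix $$\left((-1)^{k-m}\frac{[m]!}{[k+1]!}P_{k,k-m}\right)_{k,m\in\{0,\dots,n\}},$$ where the entries with $m>k$ are $0$.
   Context: $[k]=\frac{1-q^k}{1-q}$ and $[k]!=\prod_{i=1}^k [i]$ (so $[0]!=1$). For integers $j$ and $r\ge 1$, $h_j(\{1,q\}^r)$ denotes the complete homogeneous symmetric polynomial of degree $j$ in $2r$ variables, $r$ of which are specialised to $q$ and $r$ to $1$; it is $0$ when $j<0$. For $m,n\in\mathbb{N}$ let $S_{m,n}(q)=\sum_{k=1}^{n}\frac{[2k]}{[2]}[k]^{m-1}q^{\frac{m+1}{2}(n-k)}$. The polynomials $P_{m,k}\in\mathbb{Z}[q]$ ($0\le k\le m$) are the $q$-Faulhaber polynomials of Guo and Zeng, i.e. the polynomials for which, for all $m\ge 0$ and all $n\ge 1$, $$S_{2m+1,n}(q)=\sum_{k=0}^m(-1)^{m-k}\frac{[k]!}{[m+1]!}P_{m,m-k}\,q^{(m-k)n}\frac{([n][n+1])^{k+1}}{[2]}.$$ -}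

module Defs where

open import Data.Nat as ℕ using (ℕ; zero; suc; _∸_; _≤ᵇ_)
open import Data.Integer as ℤ using (ℤ; +_; -_)
open import Data.List using (List; []; _∷_; map; replicate; _++_)
open import Data.List.Relation.Unary.All using (All)
open import Data.Bool using (if_then_else_; _∧_)
open import Relation.Binary.PropositionalEquality using (_≡_)

-- Polynomials in ℤ[q]: coefficient lists, position i = coefficient of q^i.

Poly : Set
Poly = List ℤ

infixl 6 _⊕_
infixl 7 _⊗_

_⊕_ : Poly → Poly → Poly
[] ⊕ p = p
(a ∷ p) ⊕ [] = a ∷ p
(a ∷ p) ⊕ (b ∷ r) = (a ℤ.+ b) ∷ (p ⊕ r)

scale : ℤ → Poly → Poly
scale c p = map (c ℤ.*_) p

negP : Poly → Poly
negP p = map -_ p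

_⊗_ : Poly → Poly → Poly
[] ⊗ r = []
(a ∷ p) ⊗ r = scale a r ⊕ (+ 0 ∷ (p ⊗ r))

constP : ℤ → Poly
constP c = c ∷ []

zeroP oneP : Poly
zeroP = []
oneP = constP (+ 1)

qP : Poly
qP = + 0 ∷ + 1 ∷ []

_^P_ : Poly → ℕ → Poly
p ^P zero = oneP
p ^P suc n = p ⊗ (p ^P n)

IsZeroP : Poly → Set
IsZeroP p = All (_≡ + 0) p

_≈P_ : Poly → Poly → Set
p ≈P r = IsZeroP (p ⊕ negP r)

sumP : ℕ → (ℕ → Poly) → Poly
sumP zero f = zeroP
sumP (suc n) f = sumP n f ⊕ f n

qint : ℕ → Poly
qint k = sumP k (λ i → qP ^P i)

qfact : ℕ → Poly
qfact zero = oneP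
qfact (suc k) = qfact k ⊗ qint (suc k)

sign : ℕ → ℤ
sign zero = + 1
sign (suc k) = - sign k

hSym : ℕ → List Poly → Poly
hSym zero [] = oneP
hSym (suc j) [] = zeroP
hSym j (x ∷ xs) = sumP (suc j) (λ i → (x ^P i) ⊗ hSym (j ∸ i) xs)

-- the multiset of variables {1,q}^r : r copies of q and r copies of 1
vars1q : ℕ → List Poly
vars1q r = replicate r qP ++ replicate r oneP

-- a_{k,m} = h_{2m-k}({1,q}^{k-m+1}) for m ≤ k (0 if 2m-k < 0), and 0 for m > k
aEntry : ℕ → ℕ → Poly
aEntry k m =
  if (m ≤ᵇ k) ∧ (k ≤ᵇ 2 ℕ.* m)
  then hSym (2 ℕ.* m ∸ k) (vars1q (suc (k ∸ m)))
  else zeroP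

-- Rational functions in q: formal fractions num/den of polynomials,
-- equality by cross-multiplication (field of fractions of ℤ[q]).
-- All denominators used below are products of q-integers [i], i ≥ 1,
-- hence nonzero polynomials.

record Frac : Set where
  constructor _/_
  field
    num : Poly
    den : Poly
open Frac public

infix 7 _/_
infixl 6 _⊕F_
infixl 7 _⊗F_
infix 4 _≃F_

_≃F_ : Frac → Frac → Set
x ≃F y = (num x ⊗ den y) ≈P (num y ⊗ den x)

_⊕F_ : Frac → Frac → Frac
x ⊕F y = (num x ⊗ den y ⊕ num y ⊗ den x) / (den x ⊗ den y)

_⊗F_ : Frac → Frac → Frac
x ⊗F y = (num x ⊗ num y) / (den x ⊗ den y)

poly : Poly → Frac
poly p = p / oneP

zeroF oneF : Frac
zeroF = poly zeroP
oneF = poly oneP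

sumF : ℕ → (ℕ → Frac) → Frac
sumF zero f = zeroF
sumF (suc n) f = sumF n f ⊕F f n

-- S_{2m+1,n}(q) = Σ_{k=1}^{n} [2k]/[2] [k]^{2m} q^{(m+1)(n-k)}
-- (the exponent (M+1)/2 (n-k) with M = 2m+1 is (m+1)(n-k)).

SOdd : ℕ → ℕ → Frac
SOdd m n = sumF n (λ i → let k = suc i in
  (qint (2 ℕ.* k) / qint 2) ⊗F poly ((qint k ^P (2 ℕ.* m)) ⊗ (qP ^P ((suc m) ℕ.* (n ∸ k)))))

-- right-hand side of the q-Faulhaber formula of Guo–Zeng
faulhaberRHS : (ℕ → ℕ → Poly) → ℕ → ℕ → Frac
faulhaberRHS P m n = sumF (suc m) (λ k →
  (scale (sign (m ∸ k)) (qfact k) / qfact (suc m))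
  ⊗F poly (P m (m ∸ k) ⊗ (qP ^P ((m ∸ k) ℕ.* n)))
  ⊗F (((qint n ⊗ qint (suc n)) ^P (suc k)) / qint 2))

IsQFaulhaber : (ℕ → ℕ → Poly) → Set
IsQFaulhaber P = ∀ (m n : ℕ) → 1 ℕ.≤ n → SOdd m n ≃F faulhaberRHS P m n

A : ℕ → ℕ → Frac
A k m = poly (aEntry k m)

B : (ℕ → ℕ → Poly) → ℕ → ℕ → Frac
B P k m =
  if m ≤ᵇ k
  then (scale (sign (k ∸ m)) (qfact m ⊗ P k (k ∸ m)) / qfact (suc k))
  else zeroF

matMul : ℕ → (ℕ → ℕ → Frac) → (ℕ → ℕ → Frac) → ℕ → ℕ → Frac
matMul n X Y k m = sumF (suc n) (λ j → X k j ⊗F Y j m)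

δ : ℕ → ℕ → Frac
δ k m = if (k ℕ.≡ᵇ m) then oneF else zeroF

-- Work in the ring of fractions of ℤ[q] whose denominators have constant term 1.
-- Writing H r j = h_j({1,q}^r), the factorisation (1 - z)(1 - qz) of the generating
-- function gives a three-term recurrence for the a_{k,m}, and hence a two-term recurrence
-- for the row generating polynomials R_k(t, w) = ∑ₘ a_{k,m} t^{k-m} wᵐ.  With u = [N+1],
-- t = q^{N+1} and w = u² this is the recurrence of ([N+1][N+2])^{k+1} - (q[N][N+1])^{k+1}
-- divided by [2N+2], and summing over N yields
--   ([N][N+1])^{k+1} = [2] ∑ₘ a_{k,m} q^{(k-m)N} S_{2m+1,N}.
-- Substituting the q-Faulhaber formula turns this into
--   ([N][N+1])^{k+1} = ∑_{j ≤ k} (AB)_{k,j} q^{(k-j)N} ([N][N+1])^{j+1}   (N ≥ 1),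
-- and such expansions are unique: the top coefficient of a vanishing one is divisible by
-- every power of q.  Hence AB = I, and BA = I follows since A and B are lower triangular.

module Submission where

open import Defs
open import Data.Nat using (ℕ; _≤_)
open import Data.Product using (_×_)

open import Algebra.Bundles using (CommutativeRing; CommutativeSemigroup)
open import Data.Bool using (true; false; if_then_else_)
open import Data.Bool.Properties using (T-≡)
open import Data.Empty using (⊥-elim)
open import Data.Integer as ℤ using (ℤ; +_)
import Data.Integer.Properties as ℤ
open import Data.List using ([]; _∷_; replicate)
open import Data.List.Relation.Binary.Permutation.Propositional as ↭ using (_↭_)
open import Data.List.Relation.Binary.Permutation.Propositional.Properties using () renaming (shift to ↭-shift)
open import Data.List.Relation.Unary.All using ([]; _∷_)
open import Data.Maybe using (Maybe; just; nothing)
open import Data.Nat as ℕ using (zero; suc; _∸_; _<_; _≤ᵇ_; _≡ᵇ_; s≤s; z≤n)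
import Data.Nat.Properties as ℕ
open import Data.Nat.Induction using (<-rec)
open import Data.Nat.Tactic.RingSolver as ℕ-Solver using ()
open import Data.Product using (Σ-syntax; _,_; proj₁)
open import Data.Unit using (tt)
open import Function using (_∘_)
open import Function.Bundles using (Equivalence)
open import Level using (0ℓ)
open import Relation.Binary.Bundles using (Setoid)
open import Relation.Binary.Definitions using (tri<; tri≈; tri>)
open import Relation.Binary.PropositionalEquality as ≡ using (_≡_; _≢_; refl)
open import Relation.Binary.Structures using (IsEquivalence)
open import Relation.Nullary using (yes; no)
open import Relation.Nullary.Reflects using (ofʸ)
import Algebra.Properties.CommutativeSemigroup as CommSemigroupProperties
import Algebra.Properties.CommutativeSemiring.Exp as ExpProperties
import Algebra.Properties.Group as GroupProperties
import Algebra.Properties.Ring as RingProperties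
import Relation.Binary.Reasoning.Setoid as SetoidReasoning
import Tactic.RingSolver.Core.AlmostCommutativeRing as ACR
open import Tactic.RingSolver using (solve-∀)

module RangeSum {c ℓ} (R : CommutativeRing c ℓ) where

  open CommutativeRing R renaming (refl to ≈-refl; sym to ≈-sym; trans to ≈-trans)
  open CommSemigroupProperties +-commutativeSemigroup using (interchange)
  open RingProperties ring using (-‿+-comm; -0#≈0#)
  open SetoidReasoning setoid

  ∑ : ℕ → (ℕ → Carrier) → Carrier
  ∑ zero    f = 0#
  ∑ (suc n) f = ∑ n f + f n

  ∑-cong : ∀ n {f g} → (∀ i → i < n → f i ≈ g i) → ∑ n f ≈ ∑ n g
  ∑-cong zero    h = ≈-refl
  ∑-cong (suc n) h = +-cong (∑-cong n λ i i<n → h i (ℕ.m<n⇒m<1+n i<n)) (h n ℕ.≤-refl)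

  ∑-zero : ∀ n {f} → (∀ i → i < n → f i ≈ 0#) → ∑ n f ≈ 0#
  ∑-zero n {f} h = ≈-trans (∑-cong n h) (∑-0# n)
    where
    ∑-0# : ∀ n → ∑ n (λ _ → 0#) ≈ 0#
    ∑-0# zero    = ≈-refl
    ∑-0# (suc n) = ≈-trans (+-identityʳ _) (∑-0# n)

  ∑-distrib-+ : ∀ n f g → ∑ n (λ i → f i + g i) ≈ ∑ n f + ∑ n g
  ∑-distrib-+ zero    f g = ≈-sym (+-identityˡ 0#)
  ∑-distrib-+ (suc n) f g =
    ≈-trans (+-congʳ (∑-distrib-+ n f g)) (interchange (∑ n f) (∑ n g) (f n) (g n))

  ∑-distrib-neg : ∀ n f → ∑ n (λ i → - f i) ≈ - ∑ n f
  ∑-distrib-neg zero    f = ≈-sym -0#≈0#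
  ∑-distrib-neg (suc n) f = ≈-trans (+-congʳ (∑-distrib-neg n f)) (-‿+-comm (∑ n f) (f n))

  *-distribˡ-∑ : ∀ n x f → x * ∑ n f ≈ ∑ n (λ i → x * f i)
  *-distribˡ-∑ zero    x f = zeroʳ x
  *-distribˡ-∑ (suc n) x f = ≈-trans (distribˡ x (∑ n f) (f n)) (+-congʳ (*-distribˡ-∑ n x f))

  *-distribʳ-∑ : ∀ n x f → ∑ n f * x ≈ ∑ n (λ i → f i * x)
  *-distribʳ-∑ n x f = ≈-trans (*-comm (∑ n f) x)
    (≈-trans (*-distribˡ-∑ n x f) (∑-cong n λ i _ → *-comm x (f i)))

  ∑-comm : ∀ n m (f : ℕ → ℕ → Carrier) → ∑ n (λ i → ∑ m (f i)) ≈ ∑ m (λ j → ∑ n (λ i → f i j))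
  ∑-comm zero    m f = ≈-sym (∑-zero m λ _ _ → ≈-refl)
  ∑-comm (suc n) m f = begin
    ∑ n (λ i → ∑ m (f i)) + ∑ m (f n)                 ≈⟨ +-congʳ (∑-comm n m f) ⟩
    ∑ m (λ j → ∑ n (λ i → f i j)) + ∑ m (f n)         ≈⟨ ∑-distrib-+ m (λ j → ∑ n (λ i → f i j)) (f n) ⟨
    ∑ m (λ j → ∑ n (λ i → f i j) + f n j)             ∎

  ∑-head : ∀ n f → ∑ (suc n) f ≈ f 0 + ∑ n (f ∘ suc)
  ∑-head zero    f = ≈-trans (+-identityˡ (f 0)) (≈-sym (+-identityʳ (f 0)))
  ∑-head (suc n) f = ≈-trans (+-congʳ (∑-head n f)) (+-assoc (f 0) _ _)

  ∑-extend : ∀ {n n′} f → n ≤ n′ → (∀ j → n ≤ j → j < n′ → f j ≈ 0#) → ∑ n′ f ≈ ∑ n f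
  ∑-extend {n} {n′} f n≤n′ h with ℕ.m≤n⇒∃[o]m+o≡n n≤n′
  ... | k , refl = go k h
    where
    go : ∀ k → (∀ j → n ≤ j → j < n ℕ.+ k → f j ≈ 0#) → ∑ (n ℕ.+ k) f ≈ ∑ n f
    go zero    h rewrite ℕ.+-identityʳ n = ≈-refl
    go (suc k) h rewrite ℕ.+-suc n k =
      ≈-trans (+-cong (go k λ j n≤j j<n+k → h j n≤j (ℕ.m<n⇒m<1+n j<n+k))
                    (h (n ℕ.+ k) (ℕ.m≤m+n n k) ℕ.≤-refl))
            (+-identityʳ (∑ n f))

  ∑-single : ∀ n i f → i < n → (∀ j → j < n → j ≢ i → f j ≈ 0#) → ∑ n f ≈ f i
  ∑-single (suc n) i f i<1+n h with i ℕ.≟ n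
  ... | yes refl = ≈-trans (+-congʳ (∑-zero n λ j j<n → h j (ℕ.m<n⇒m<1+n j<n) (ℕ.<⇒≢ j<n)))
                         (+-identityˡ (f i))
  ... | no  i≢n  = ≈-trans (+-cong (∑-single n i f (ℕ.≤∧≢⇒< (ℕ.≤-pred i<1+n) i≢n)
                                   λ j j<n → h j (ℕ.m<n⇒m<1+n j<n))
                                 (h n ℕ.≤-refl (i≢n ∘ ≡.sym)))
                         (+-identityʳ (f i))

module LinearRecurrence {c ℓ} (R : CommutativeRing c ℓ) where

  open CommutativeRing R

  SolvesRecurrence : Carrier → Carrier → (ℕ → Carrier) → Set ℓ
  SolvesRecurrence α β s = ∀ k → s (2 ℕ.+ k) ≈ α * s (suc k) - β * s k

  recurrence-unique : ∀ {α β s s′} → SolvesRecurrence α β s → SolvesRecurrence α β s′ →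
                      s 0 ≈ s′ 0 → s 1 ≈ s′ 1 → ∀ k → s k ≈ s′ k
  recurrence-unique {α} {β} {s} {s′} rec rec′ s₀ s₁ k = proj₁ (consecutive k)
    where
    consecutive : ∀ k → s k ≈ s′ k × s (suc k) ≈ s′ (suc k)
    consecutive zero    = s₀ , s₁
    consecutive (suc k) with consecutive k
    ... | sₖ , sₖ₊₁ = sₖ₊₁ , trans (rec k) (trans (+-cong (*-congˡ sₖ₊₁) (-‿cong (*-congˡ sₖ))) (sym (rec′ k)))

  SolvesRecurrence-cong : ∀ {α α′ β β′ s} → α ≈ α′ → β ≈ β′ → SolvesRecurrence α β s → SolvesRecurrence α′ β′ s
  SolvesRecurrence-cong α≈α′ β≈β′ rec k = trans (rec k) (+-cong (*-congʳ α≈α′) (-‿cong (*-congʳ β≈β′)))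

module Matrices {c ℓ} (R : CommutativeRing c ℓ) where

  open CommutativeRing R renaming (refl to ≈-refl; sym to ≈-sym; trans to ≈-trans)
  open RangeSum R
  open RingProperties ring using (x∙y⁻¹≈ε⇒x≈y; x≈y⇒x∙y⁻¹≈ε; x[y-z]≈xy-xz)
  open SetoidReasoning setoid

  Matrix : Set c
  Matrix = ℕ → ℕ → Carrier

  _×[_]_ : Matrix → ℕ → Matrix → Matrix
  (M ×[ n ] N) k m = ∑ (suc n) (λ j → M k j * N j m)

  I : Matrix
  I k m = if k ≡ᵇ m then 1# else 0#

  I-diagonal : ∀ k → I k k ≈ 1#
  I-diagonal zero    = ≈-refl
  I-diagonal (suc k) = I-diagonal k

  I-off-diagonal : ∀ {k m} → k ≢ m → I k m ≈ 0#
  I-off-diagonal {k} {m} k≢m with k ≡ᵇ m | ℕ.≡ᵇ⇒≡ k m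
  ... | false | _    = ≈-refl
  ... | true  | k≡m = ⊥-elim (k≢m (k≡m tt))

  LowerTriangular : Matrix → Set ℓ
  LowerTriangular M = ∀ {k m} → k < m → M k m ≈ 0#

  _≈[_]_ : Matrix → ℕ → Matrix → Set ℓ
  M ≈[ n ] N = ∀ {k m} → k ≤ n → m ≤ n → M k m ≈ N k m

  ×-assoc : ∀ n M N P k m → (M ×[ n ] (N ×[ n ] P)) k m ≈ ((M ×[ n ] N) ×[ n ] P) k m
  ×-assoc n M N P k m = begin
    ∑ (suc n) (λ j → M k j * ∑ (suc n) (λ l → N j l * P l m))
      ≈⟨ ∑-cong (suc n) (λ j _ → *-distribˡ-∑ (suc n) (M k j) (λ l → N j l * P l m)) ⟩
    ∑ (suc n) (λ j → ∑ (suc n) (λ l → M k j * (N j l * P l m)))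
      ≈⟨ ∑-comm (suc n) (suc n) (λ j l → M k j * (N j l * P l m)) ⟩
    ∑ (suc n) (λ l → ∑ (suc n) (λ j → M k j * (N j l * P l m)))
      ≈⟨ ∑-cong (suc n) (λ l _ → ∑-cong (suc n) (λ j _ → ≈-sym (*-assoc (M k j) (N j l) (P l m)))) ⟩
    ∑ (suc n) (λ l → ∑ (suc n) (λ j → (M k j * N j l) * P l m))
      ≈⟨ ∑-cong (suc n) (λ l _ → *-distribʳ-∑ (suc n) (P l m) (λ j → M k j * N j l)) ⟨
    ∑ (suc n) (λ l → (M ×[ n ] N) k l * P l m)
      ∎

  I-×ˡ : ∀ n M {k} m → k ≤ n → (I ×[ n ] M) k m ≈ M k m
  I-×ˡ n M {k} m k≤n = begin
    ∑ (suc n) (λ l → I k l * M l m)   ≈⟨ ∑-single (suc n) k _ (s≤s k≤n) (λ l _ l≢k →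
                                            ≈-trans (*-congʳ (I-off-diagonal (l≢k ∘ ≡.sym))) (zeroˡ (M l m))) ⟩
    I k k * M k m                     ≈⟨ *-congʳ (I-diagonal k) ⟩
    1# * M k m                        ≈⟨ *-identityˡ (M k m) ⟩
    M k m                             ∎

  ×-Iʳ : ∀ n M k {m} → m ≤ n → (M ×[ n ] I) k m ≈ M k m
  ×-Iʳ n M k {m} m≤n = begin
    ∑ (suc n) (λ l → M k l * I l m)   ≈⟨ ∑-single (suc n) m _ (s≤s m≤n) (λ l _ l≢m →
                                            ≈-trans (*-congˡ (I-off-diagonal l≢m)) (zeroʳ (M k l))) ⟩
    M k m * I m m                     ≈⟨ *-congˡ (I-diagonal m) ⟩
    M k m * 1#                        ≈⟨ *-identityʳ (M k m) ⟩
    M k m                             ∎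

  ×-diagonal : ∀ n {M N} → LowerTriangular M → LowerTriangular N → ∀ {k} → k ≤ n → (M ×[ n ] N) k k ≈ M k k * N k k
  ×-diagonal n {M} {N} M-lower N-lower {k} k≤n = ∑-single (suc n) k _ (s≤s k≤n) off-diagonal
    where
    off-diagonal : ∀ l → l < suc n → l ≢ k → M k l * N l k ≈ 0#
    off-diagonal l _ l≢k with ℕ.<-cmp l k
    ... | tri< l<k _ _ = ≈-trans (*-congˡ (N-lower l<k)) (zeroʳ (M k l))
    ... | tri≈ _ l≡k _ = ⊥-elim (l≢k l≡k)
    ... | tri> _ _ k<l = ≈-trans (*-congʳ (M-lower k<l)) (zeroˡ (N l k))

  -- Column m of B A - I is killed by A, whose diagonal is invertible (A k k B k k = 1):
  -- forward substitution.
  right-inverse⇒left-inverse : ∀ n {A B} → LowerTriangular A → LowerTriangular B →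
                               (A ×[ n ] B) ≈[ n ] I → (B ×[ n ] A) ≈[ n ] I
  right-inverse⇒left-inverse n {A} {B} A-lower B-lower AB≈I {k} {m} k≤n m≤n =
    x∙y⁻¹≈ε⇒x≈y _ _ (<-rec (λ k → k ≤ n → E k ≈ 0#) E-vanishes k k≤n)
    where
    E : ℕ → Carrier
    E j = (B ×[ n ] A) j m - I j m

    A-kills-E : ∀ {k} → k ≤ n → ∑ (suc n) (λ j → A k j * E j) ≈ 0#
    A-kills-E {k} k≤n = begin
      ∑ (suc n) (λ j → A k j * E j)
        ≈⟨ ∑-cong (suc n) (λ j _ → x[y-z]≈xy-xz (A k j) _ _) ⟩
      ∑ (suc n) (λ j → A k j * (B ×[ n ] A) j m - A k j * I j m)
        ≈⟨ ≈-trans (∑-distrib-+ (suc n) _ _) (+-congˡ (∑-distrib-neg (suc n) _)) ⟩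
      (A ×[ n ] (B ×[ n ] A)) k m - (A ×[ n ] I) k m
        ≈⟨ +-cong (×-assoc n A B A k m) (-‿cong (×-Iʳ n A k m≤n)) ⟩
      ((A ×[ n ] B) ×[ n ] A) k m - A k m
        ≈⟨ +-congʳ (∑-cong (suc n) (λ l l<1+n → *-congʳ (AB≈I k≤n (ℕ.≤-pred l<1+n)))) ⟩
      (I ×[ n ] A) k m - A k m
        ≈⟨ x≈y⇒x∙y⁻¹≈ε (I-×ˡ n A m k≤n) ⟩
      0# ∎

    diagonal-inverse : ∀ {k} → k ≤ n → B k k * A k k ≈ 1#
    diagonal-inverse {k} k≤n =
      ≈-trans (*-comm (B k k) (A k k)) (≈-trans (≈-sym (×-diagonal n A-lower B-lower k≤n)) (≈-trans (AB≈I k≤n k≤n) (I-diagonal k)))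

    E-vanishes : ∀ k → (∀ {j} → j < k → j ≤ n → E j ≈ 0#) → k ≤ n → E k ≈ 0#
    E-vanishes k earlier k≤n = begin
      E k                           ≈⟨ *-identityˡ (E k) ⟨
      1# * E k                      ≈⟨ *-congʳ (diagonal-inverse k≤n) ⟨
      (B k k * A k k) * E k         ≈⟨ *-assoc (B k k) (A k k) (E k) ⟩
      B k k * (A k k * E k)         ≈⟨ *-congˡ (∑-single (suc n) k _ (s≤s k≤n) off-diagonal) ⟨
      B k k * ∑ (suc n) (λ j → A k j * E j) ≈⟨ *-congˡ (A-kills-E k≤n) ⟩
      B k k * 0#                    ≈⟨ zeroʳ (B k k) ⟩
      0#                            ∎
      where
      off-diagonal : ∀ j → j < suc n → j ≢ k → A k j * E j ≈ 0#
      off-diagonal j j<1+n j≢k with ℕ.<-cmp j k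
      ... | tri< j<k _ _ = ≈-trans (*-congˡ (earlier j<k (ℕ.≤-pred j<1+n))) (zeroʳ (A k j))
      ... | tri≈ _ j≡k _ = ⊥-elim (j≢k j≡k)
      ... | tri> _ _ k<j = ≈-trans (*-congʳ (A-lower k<j)) (zeroˡ (E j))

  ×-lower : ∀ n {M N} → LowerTriangular M → LowerTriangular N → LowerTriangular (M ×[ n ] N)
  ×-lower n {M} {N} M-lower N-lower {k} {m} k<m = ∑-zero (suc n) vanishing
    where
    vanishing : ∀ j → j < suc n → M k j * N j m ≈ 0#
    vanishing j _ with k ℕ.<? j
    ... | yes k<j = ≈-trans (*-congʳ (M-lower k<j)) (zeroˡ (N j m))
    ... | no  k≮j = ≈-trans (*-congˡ (N-lower (ℕ.≤-<-trans (ℕ.≮⇒≥ k≮j) k<m))) (zeroʳ (M k j))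

-- The polynomial ring ℤ[q]

coeff : Poly → ℕ → ℤ
coeff []      i       = + 0
coeff (a ∷ p) zero    = a
coeff (a ∷ p) (suc i) = coeff p i

infix 4 _≋_
record _≋_ (p r : Poly) : Set where
  constructor coeffwise
  field coeff-≡ : ∀ i → coeff p i ≡ coeff r i
open _≋_ public

≋-refl : ∀ {p} → p ≋ p
≋-refl = coeffwise λ i → refl

≋-sym : ∀ {p r} → p ≋ r → r ≋ p
≋-sym h = coeffwise λ i → ≡.sym (coeff-≡ h i)

≋-trans : ∀ {p r s} → p ≋ r → r ≋ s → p ≋ s
≋-trans h g = coeffwise λ i → ≡.trans (coeff-≡ h i) (coeff-≡ g i)

≋-reflexive : ∀ {p r} → p ≡ r → p ≋ r
≋-reflexive refl = ≋-refl

≋-isEquivalence : IsEquivalence _≋_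
≋-isEquivalence = record { refl = ≋-refl ; sym = ≋-sym ; trans = ≋-trans }

≋-setoid : Setoid 0ℓ 0ℓ
≋-setoid = record { isEquivalence = ≋-isEquivalence }

module ≋-Reasoning = SetoidReasoning ≋-setoid

∷-cong : ∀ {a b p r} → a ≡ b → p ≋ r → a ∷ p ≋ b ∷ r
∷-cong a≡b h = coeffwise λ { zero → a≡b ; (suc i) → coeff-≡ h i }

coeff-⊕ : ∀ p r i → coeff (p ⊕ r) i ≡ coeff p i ℤ.+ coeff r i
coeff-⊕ []      r       i       = ≡.sym (ℤ.+-identityˡ _)
coeff-⊕ (a ∷ p) []      i       = ≡.sym (ℤ.+-identityʳ _)
coeff-⊕ (a ∷ p) (b ∷ r) zero    = refl
coeff-⊕ (a ∷ p) (b ∷ r) (suc i) = coeff-⊕ p r i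

coeff-scale : ∀ c p i → coeff (scale c p) i ≡ c ℤ.* coeff p i
coeff-scale c []      i       = ≡.sym (ℤ.*-zeroʳ c)
coeff-scale c (a ∷ p) zero    = refl
coeff-scale c (a ∷ p) (suc i) = coeff-scale c p i

coeff-negP : ∀ p i → coeff (negP p) i ≡ ℤ.- coeff p i
coeff-negP []      i       = refl
coeff-negP (a ∷ p) zero    = refl
coeff-negP (a ∷ p) (suc i) = coeff-negP p i

⊕-cong : ∀ {p p′ r r′} → p ≋ p′ → r ≋ r′ → p ⊕ r ≋ p′ ⊕ r′
⊕-cong {p} {p′} {r} {r′} h g = coeffwise λ i → begin
  coeff (p ⊕ r) i               ≡⟨ coeff-⊕ p r i ⟩
  coeff p i ℤ.+ coeff r i       ≡⟨ ≡.cong₂ ℤ._+_ (coeff-≡ h i) (coeff-≡ g i) ⟩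
  coeff p′ i ℤ.+ coeff r′ i     ≡⟨ coeff-⊕ p′ r′ i ⟨
  coeff (p′ ⊕ r′) i             ∎
  where open ≡.≡-Reasoning

⊕-assoc : ∀ p r s → (p ⊕ r) ⊕ s ≋ p ⊕ (r ⊕ s)
⊕-assoc p r s = coeffwise λ i → begin
  coeff ((p ⊕ r) ⊕ s) i                      ≡⟨ coeff-⊕ (p ⊕ r) s i ⟩
  coeff (p ⊕ r) i ℤ.+ coeff s i              ≡⟨ ≡.cong₂ ℤ._+_ (coeff-⊕ p r i) refl ⟩
  coeff p i ℤ.+ coeff r i ℤ.+ coeff s i      ≡⟨ ℤ.+-assoc (coeff p i) _ _ ⟩
  coeff p i ℤ.+ (coeff r i ℤ.+ coeff s i)    ≡⟨ ≡.cong₂ ℤ._+_ (refl {x = coeff p i}) (coeff-⊕ r s i) ⟨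
  coeff p i ℤ.+ coeff (r ⊕ s) i              ≡⟨ coeff-⊕ p (r ⊕ s) i ⟨
  coeff (p ⊕ (r ⊕ s)) i                      ∎
  where open ≡.≡-Reasoning

⊕-comm : ∀ p r → p ⊕ r ≋ r ⊕ p
⊕-comm p r = coeffwise λ i →
  ≡.trans (coeff-⊕ p r i) (≡.trans (ℤ.+-comm (coeff p i) _) (≡.sym (coeff-⊕ r p i)))

⊕-identityʳ : ∀ p → p ⊕ [] ≋ p
⊕-identityʳ []      = ≋-refl
⊕-identityʳ (a ∷ p) = ≋-refl

negP-inverseˡ : ∀ p → negP p ⊕ p ≋ []
negP-inverseˡ p = coeffwise λ i → begin
  coeff (negP p ⊕ p) i                 ≡⟨ coeff-⊕ (negP p) p i ⟩
  coeff (negP p) i ℤ.+ coeff p i       ≡⟨ ≡.cong₂ ℤ._+_ (coeff-negP p i) refl ⟩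
  ℤ.- coeff p i ℤ.+ coeff p i            ≡⟨ ℤ.+-inverseˡ (coeff p i) ⟩
  + 0                                  ∎
  where open ≡.≡-Reasoning

negP-inverseʳ : ∀ p → p ⊕ negP p ≋ []
negP-inverseʳ p = ≋-trans (⊕-comm p (negP p)) (negP-inverseˡ p)

negP-cong : ∀ {p r} → p ≋ r → negP p ≋ negP r
negP-cong {p} {r} h = coeffwise λ i →
  ≡.trans (coeff-negP p i) (≡.trans (≡.cong ℤ.-_ (coeff-≡ h i)) (≡.sym (coeff-negP r i)))

⊕-congˡ : ∀ p {r r′} → r ≋ r′ → p ⊕ r ≋ p ⊕ r′
⊕-congˡ p = ⊕-cong ≋-refl

⊕-congʳ : ∀ r {p p′} → p ≋ p′ → p ⊕ r ≋ p′ ⊕ r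
⊕-congʳ r h = ⊕-cong h ≋-refl

⊕-commutativeSemigroup : CommutativeSemigroup 0ℓ 0ℓ
⊕-commutativeSemigroup = record
  { isCommutativeSemigroup = record
    { isSemigroup = record
      { isMagma = record { isEquivalence = ≋-isEquivalence ; ∙-cong = ⊕-cong }
      ; assoc = ⊕-assoc }
    ; comm = ⊕-comm } }

open CommSemigroupProperties ⊕-commutativeSemigroup using () renaming (interchange to ⊕-interchange; x∙yz≈y∙xz to ⊕-x∙yz≈y∙xz)

scale-cong : ∀ c {p r} → p ≋ r → scale c p ≋ scale c r
scale-cong c {p} {r} h = coeffwise λ i →
  ≡.trans (coeff-scale c p i) (≡.trans (≡.cong (c ℤ.*_) (coeff-≡ h i)) (≡.sym (coeff-scale c r i)))

scale-distribʳ : ∀ a b p → scale (a ℤ.+ b) p ≋ scale a p ⊕ scale b p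
scale-distribʳ a b p = coeffwise λ i → begin
  coeff (scale (a ℤ.+ b) p) i                        ≡⟨ coeff-scale (a ℤ.+ b) p i ⟩
  (a ℤ.+ b) ℤ.* coeff p i                            ≡⟨ ℤ.*-distribʳ-+ (coeff p i) a b ⟩
  a ℤ.* coeff p i ℤ.+ b ℤ.* coeff p i                ≡⟨ ≡.cong₂ ℤ._+_ (coeff-scale a p i) (coeff-scale b p i) ⟨
  coeff (scale a p) i ℤ.+ coeff (scale b p) i        ≡⟨ coeff-⊕ (scale a p) (scale b p) i ⟨
  coeff (scale a p ⊕ scale b p) i                    ∎
  where open ≡.≡-Reasoning

scale-distribˡ : ∀ c p r → scale c (p ⊕ r) ≋ scale c p ⊕ scale c r
scale-distribˡ c p r = coeffwise λ i → begin
  coeff (scale c (p ⊕ r)) i                          ≡⟨ coeff-scale c (p ⊕ r) i ⟩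
  c ℤ.* coeff (p ⊕ r) i                              ≡⟨ ≡.cong (c ℤ.*_) (coeff-⊕ p r i) ⟩
  c ℤ.* (coeff p i ℤ.+ coeff r i)                    ≡⟨ ℤ.*-distribˡ-+ c (coeff p i) _ ⟩
  c ℤ.* coeff p i ℤ.+ c ℤ.* coeff r i                ≡⟨ ≡.cong₂ ℤ._+_ (coeff-scale c p i) (coeff-scale c r i) ⟨
  coeff (scale c p) i ℤ.+ coeff (scale c r) i        ≡⟨ coeff-⊕ (scale c p) (scale c r) i ⟨
  coeff (scale c p ⊕ scale c r) i                    ∎
  where open ≡.≡-Reasoning

scale-assoc : ∀ a b p → scale (a ℤ.* b) p ≋ scale a (scale b p)
scale-assoc a b p = coeffwise λ i → begin
  coeff (scale (a ℤ.* b) p) i          ≡⟨ coeff-scale (a ℤ.* b) p i ⟩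
  a ℤ.* b ℤ.* coeff p i                ≡⟨ ℤ.*-assoc a b (coeff p i) ⟩
  a ℤ.* (b ℤ.* coeff p i)              ≡⟨ ≡.cong (a ℤ.*_) (coeff-scale b p i) ⟨
  a ℤ.* coeff (scale b p) i            ≡⟨ coeff-scale a (scale b p) i ⟨
  coeff (scale a (scale b p)) i        ∎
  where open ≡.≡-Reasoning

scale-zero : ∀ p → scale (+ 0) p ≋ []
scale-zero p = coeffwise (coeff-scale (+ 0) p)

scale-one : ∀ p → scale (+ 1) p ≋ p
scale-one p = coeffwise λ i → ≡.trans (coeff-scale (+ 1) p i) (ℤ.*-identityˡ (coeff p i))

infixr 8 q·_
q·_ : Poly → Poly
q· p = + 0 ∷ p

q·-[] : q· [] ≋ []
q·-[] = coeffwise λ { zero → refl ; (suc i) → refl }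

q·-cong : ∀ {p r} → p ≋ r → q· p ≋ q· r
q·-cong = ∷-cong refl

scale-q· : ∀ c p → scale c (q· p) ≋ q· (scale c p)
scale-q· c p = ∷-cong (ℤ.*-zeroʳ c) ≋-refl

⊗-zeroʳ : ∀ p → p ⊗ [] ≋ []
⊗-zeroʳ []      = ≋-refl
⊗-zeroʳ (a ∷ p) = ≋-trans (q·-cong (⊗-zeroʳ p)) q·-[]

⊗-zeroˡ-≋ : ∀ {p} r → p ≋ [] → p ⊗ r ≋ []
⊗-zeroˡ-≋ {[]}    r h = ≋-refl
⊗-zeroˡ-≋ {a ∷ p} r h = begin
  scale a r ⊕ q· (p ⊗ r)       ≈⟨ ⊕-cong (scale-cong′ (coeff-≡ h 0)) (q·-cong (⊗-zeroˡ-≋ r (tail h))) ⟩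
  scale (+ 0) r ⊕ q· []        ≈⟨ ⊕-cong (scale-zero r) q·-[] ⟩
  []                              ∎
  where
  open ≋-Reasoning
  scale-cong′ : ∀ {a b} → a ≡ b → scale a r ≋ scale b r
  scale-cong′ refl = ≋-refl
  tail : a ∷ p ≋ [] → p ≋ []
  tail h = coeffwise λ i → coeff-≡ h (suc i)

⊗-congʳ : ∀ {p p′} r → p ≋ p′ → p ⊗ r ≋ p′ ⊗ r
⊗-congʳ {[]}    r h = ≋-sym (⊗-zeroˡ-≋ r (≋-sym h))
⊗-congʳ {a ∷ p} {[]} r h = ⊗-zeroˡ-≋ r h
⊗-congʳ {a ∷ p} {b ∷ p′} r h with coeff-≡ h 0
... | refl = ⊕-congˡ (scale a r) (q·-cong (⊗-congʳ {p} {p′} r (coeffwise λ i → coeff-≡ h (suc i))))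

⊗-congˡ : ∀ p {r r′} → r ≋ r′ → p ⊗ r ≋ p ⊗ r′
⊗-congˡ []      h = ≋-refl
⊗-congˡ (a ∷ p) h = ⊕-cong (scale-cong a h) (q·-cong (⊗-congˡ p h))

⊗-cong : ∀ {p p′ r r′} → p ≋ p′ → r ≋ r′ → p ⊗ r ≋ p′ ⊗ r′
⊗-cong {p′ = p′} {r} h g = ≋-trans (⊗-congʳ r h) (⊗-congˡ p′ g)

⊗-distribʳ : ∀ p p′ r → (p ⊕ p′) ⊗ r ≋ p ⊗ r ⊕ p′ ⊗ r
⊗-distribʳ []      p′       r = ≋-refl
⊗-distribʳ (a ∷ p) []       r = ≋-sym (⊕-identityʳ _)
⊗-distribʳ (a ∷ p) (b ∷ p′) r = begin
  scale (a ℤ.+ b) r ⊕ q· ((p ⊕ p′) ⊗ r)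
    ≈⟨ ⊕-cong (scale-distribʳ a b r) (q·-cong (⊗-distribʳ p p′ r)) ⟩
  (scale a r ⊕ scale b r) ⊕ (q· (p ⊗ r) ⊕ q· (p′ ⊗ r))
    ≈⟨ ⊕-interchange (scale a r) (scale b r) (q· (p ⊗ r)) (q· (p′ ⊗ r)) ⟩
  (scale a r ⊕ q· (p ⊗ r)) ⊕ (scale b r ⊕ q· (p′ ⊗ r))
    ∎
  where open ≋-Reasoning

⊗-distribˡ : ∀ p r s → p ⊗ (r ⊕ s) ≋ p ⊗ r ⊕ p ⊗ s
⊗-distribˡ []      r s = ≋-refl
⊗-distribˡ (a ∷ p) r s = begin
  scale a (r ⊕ s) ⊕ q· (p ⊗ (r ⊕ s))
    ≈⟨ ⊕-cong (scale-distribˡ a r s) (q·-cong (⊗-distribˡ p r s)) ⟩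
  (scale a r ⊕ scale a s) ⊕ (q· (p ⊗ r) ⊕ q· (p ⊗ s))
    ≈⟨ ⊕-interchange (scale a r) (scale a s) (q· (p ⊗ r)) (q· (p ⊗ s)) ⟩
  (scale a r ⊕ q· (p ⊗ r)) ⊕ (scale a s ⊕ q· (p ⊗ s))
    ∎
  where open ≋-Reasoning

⊗-scaleˡ : ∀ c p r → scale c p ⊗ r ≋ scale c (p ⊗ r)
⊗-scaleˡ c []      r = ≋-refl
⊗-scaleˡ c (a ∷ p) r = begin
  scale (c ℤ.* a) r ⊕ q· (scale c p ⊗ r)       ≈⟨ ⊕-cong (scale-assoc c a r) (q·-cong (⊗-scaleˡ c p r)) ⟩
  scale c (scale a r) ⊕ q· (scale c (p ⊗ r))   ≈⟨ ⊕-congˡ (scale c (scale a r)) (scale-q· c (p ⊗ r)) ⟨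
  scale c (scale a r) ⊕ scale c (q· (p ⊗ r))   ≈⟨ scale-distribˡ c (scale a r) (q· (p ⊗ r)) ⟨
  scale c (scale a r ⊕ q· (p ⊗ r))             ∎
  where open ≋-Reasoning

⊗-q·ˡ : ∀ p r → q· p ⊗ r ≋ q· (p ⊗ r)
⊗-q·ˡ p r = ⊕-cong (scale-zero r) ≋-refl

⊗-∷ʳ : ∀ p b r → p ⊗ (b ∷ r) ≋ scale b p ⊕ q· (p ⊗ r)
⊗-∷ʳ []      b r = ≋-sym q·-[]
⊗-∷ʳ (a ∷ p) b r = ∷-cong (≡.cong (ℤ._+ + 0) (ℤ.*-comm a b)) (begin
  scale a r ⊕ p ⊗ (b ∷ r)                  ≈⟨ ⊕-congˡ (scale a r) (⊗-∷ʳ p b r) ⟩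
  scale a r ⊕ (scale b p ⊕ q· (p ⊗ r))  ≈⟨ ⊕-x∙yz≈y∙xz (scale a r) (scale b p) (q· (p ⊗ r)) ⟩
  scale b p ⊕ (scale a r ⊕ q· (p ⊗ r))  ∎)
  where open ≋-Reasoning

⊗-comm : ∀ p r → p ⊗ r ≋ r ⊗ p
⊗-comm []      r = ≋-sym (⊗-zeroʳ r)
⊗-comm (a ∷ p) r = ≋-trans (⊕-congˡ (scale a r) (q·-cong (⊗-comm p r))) (≋-sym (⊗-∷ʳ r a p))

⊗-assoc : ∀ p r s → (p ⊗ r) ⊗ s ≋ p ⊗ (r ⊗ s)
⊗-assoc []      r s = ≋-refl
⊗-assoc (a ∷ p) r s = begin
  (scale a r ⊕ q· (p ⊗ r)) ⊗ s              ≈⟨ ⊗-distribʳ (scale a r) (q· (p ⊗ r)) s ⟩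
  scale a r ⊗ s ⊕ q· (p ⊗ r) ⊗ s            ≈⟨ ⊕-cong (⊗-scaleˡ a r s) (⊗-q·ˡ (p ⊗ r) s) ⟩
  scale a (r ⊗ s) ⊕ q· ((p ⊗ r) ⊗ s)        ≈⟨ ⊕-congˡ (scale a (r ⊗ s)) (q·-cong (⊗-assoc p r s)) ⟩
  scale a (r ⊗ s) ⊕ q· (p ⊗ (r ⊗ s))        ∎
  where open ≋-Reasoning

⊗-identityˡ : ∀ p → oneP ⊗ p ≋ p
⊗-identityˡ p = ≋-trans (⊕-cong (scale-one p) q·-[]) (⊕-identityʳ p)

⊗-identityʳ : ∀ p → p ⊗ oneP ≋ p
⊗-identityʳ p = ≋-trans (⊗-comm p oneP) (⊗-identityˡ p)

polyRing : CommutativeRing 0ℓ 0ℓ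
polyRing = record
  { Carrier = Poly ; _≈_ = _≋_ ; _+_ = _⊕_ ; _*_ = _⊗_ ; -_ = negP ; 0# = [] ; 1# = oneP
  ; isCommutativeRing = record
    { isRing = record
      { +-isAbelianGroup = record
        { isGroup = record
          { isMonoid = record
            { isSemigroup = record
              { isMagma = record { isEquivalence = ≋-isEquivalence ; ∙-cong = ⊕-cong }
              ; assoc = ⊕-assoc }
            ; identity = (λ p → ≋-refl) , ⊕-identityʳ }
          ; inverse = negP-inverseˡ , negP-inverseʳ
          ; ⁻¹-cong = negP-cong }
        ; comm = ⊕-comm }
      ; *-cong = ⊗-cong
      ; *-assoc = ⊗-assoc
      ; *-identity = ⊗-identityˡ , ⊗-identityʳ
      ; distrib = ⊗-distribˡ , (λ r p p′ → ⊗-distribʳ p p′ r) }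
    ; *-comm = ⊗-comm } }

open CommSemigroupProperties (CommutativeRing.*-commutativeSemigroup polyRing) public
  using () renaming (x∙yz≈y∙xz to ⊗-x∙yz≈y∙xz)

IsZeroP⇒≋[] : ∀ {p} → IsZeroP p → p ≋ []
IsZeroP⇒≋[] []          = ≋-refl
IsZeroP⇒≋[] (a≡0 ∷ h) = ≋-trans (∷-cong a≡0 (IsZeroP⇒≋[] h)) q·-[]

≋[]⇒IsZeroP : ∀ {p} → p ≋ [] → IsZeroP p
≋[]⇒IsZeroP {[]}    h = []
≋[]⇒IsZeroP {a ∷ p} h = coeff-≡ h 0 ∷ ≋[]⇒IsZeroP (coeffwise λ i → coeff-≡ h (suc i))

open GroupProperties (CommutativeRing.+-group polyRing) using ()
  renaming (x∙y⁻¹≈ε⇒x≈y to x-y≋[]⇒x≋y; x≈y⇒x∙y⁻¹≈ε to x≋y⇒x-y≋[])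

≈P⇒≋ : ∀ {p r} → p ≈P r → p ≋ r
≈P⇒≋ h = x-y≋[]⇒x≋y _ _ (IsZeroP⇒≋[] h)

≋⇒≈P : ∀ {p r} → p ≋ r → p ≈P r
≋⇒≈P h = ≋[]⇒IsZeroP (x≋y⇒x-y≋[] h)

open RangeSum polyRing using () renaming
  ( ∑ to ∑ₚ; ∑-cong to ∑ₚ-cong; ∑-head to ∑ₚ-head; ∑-extend to ∑ₚ-extend
  ; ∑-distrib-+ to ∑ₚ-distrib-+; ∑-distrib-neg to ∑ₚ-distrib-neg; *-distribˡ-∑ to *-distribˡ-∑ₚ )

≟[] : (p : Poly) → Maybe ([] ≋ p)
≟[] []      = just ≋-refl
≟[] (a ∷ p) with a ℤ.≟ + 0 | ≟[] p
... | yes a≡0 | just p≋[] = just (≋-sym (≋-trans (∷-cong a≡0 (≋-sym p≋[])) q·-[]))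
... | _       | _         = nothing

polyACR : ACR.AlmostCommutativeRing 0ℓ 0ℓ
polyACR = ACR.fromCommutativeRing polyRing ≟[]

-- Fractions with denominators of constant term 1

record ConstantTermOne (d : Poly) : Set where
  constructor constantTermOne
  field coeff₀≡1 : coeff d 0 ≡ + 1
open ConstantTermOne public

coeff-⊗-0 : ∀ a p r → coeff ((a ∷ p) ⊗ r) 0 ≡ a ℤ.* coeff r 0 ℤ.+ + 0
coeff-⊗-0 a p r = ≡.trans (coeff-⊕ (scale a r) (q· (p ⊗ r)) 0) (≡.cong (ℤ._+ + 0) (coeff-scale a r 0))

constantTermOne-⊗ : ∀ {d e} → ConstantTermOne d → ConstantTermOne e → ConstantTermOne (d ⊗ e)
constantTermOne-⊗ {a ∷ d} {e} (constantTermOne refl) (constantTermOne e₀≡1) =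
  constantTermOne (≡.trans (coeff-⊗-0 (+ 1) d e) (≡.cong (λ x → + 1 ℤ.* x ℤ.+ + 0) e₀≡1))

VanishesBelow : ℕ → Poly → Set
VanishesBelow N p = ∀ i → i < N → coeff p i ≡ + 0

vanishesBelow-cancel : ∀ N p {d} → ConstantTermOne d → VanishesBelow N (p ⊗ d) → VanishesBelow N p
vanishesBelow-cancel N       []      d₀≡1 h i i<N = refl
vanishesBelow-cancel (suc N) (a ∷ p) {d} d₀≡1 h i i<N with a≡0
  where
  a≡0 : a ≡ + 0
  a≡0 = begin
    a                             ≡⟨ ℤ.*-identityʳ a ⟨
    a ℤ.* + 1                     ≡⟨ ≡.cong (a ℤ.*_) (coeff₀≡1 d₀≡1) ⟨
    a ℤ.* coeff d 0               ≡⟨ ℤ.+-identityʳ _ ⟨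
    a ℤ.* coeff d 0 ℤ.+ + 0       ≡⟨ coeff-⊗-0 a p d ⟨
    coeff ((a ∷ p) ⊗ d) 0         ≡⟨ h 0 (s≤s z≤n) ⟩
    + 0                           ∎
    where open ≡.≡-Reasoning
vanishesBelow-cancel (suc N) (a ∷ p) d₀≡1 h zero    i<N       | refl = refl
vanishesBelow-cancel (suc N) (a ∷ p) {d} d₀≡1 h (suc i) (s≤s i<N) | refl =
  vanishesBelow-cancel N p d₀≡1 (λ j j<N → ≡.trans (≡.sym (coeff-≡ (⊗-q·ˡ p d) (suc j))) (h (suc j) (s≤s j<N))) i i<N

≋[]-cancel : ∀ p {d} → ConstantTermOne d → p ⊗ d ≋ [] → p ≋ []
≋[]-cancel p d₀≡1 h = coeffwise λ i →
  vanishesBelow-cancel (suc i) p d₀≡1 (λ j _ → coeff-≡ h j) i ℕ.≤-refl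

qP-⊗ : ∀ s → qP ⊗ s ≋ q· s
qP-⊗ s = ≋-trans (⊗-q·ˡ oneP s) (q·-cong (⊗-identityˡ s))

qP^-⊗ : ∀ N s → qP ^P suc N ⊗ s ≋ q· (qP ^P N ⊗ s)
qP^-⊗ N s = ≋-trans (⊗-assoc qP (qP ^P N) s) (qP-⊗ _)

coeff-qP^-⊗ : ∀ N s i → coeff (qP ^P N ⊗ s) (N ℕ.+ i) ≡ coeff s i
coeff-qP^-⊗ zero    s i = coeff-≡ (⊗-identityˡ s) i
coeff-qP^-⊗ (suc N) s i = ≡.trans (coeff-≡ (qP^-⊗ N s) (suc (N ℕ.+ i))) (coeff-qP^-⊗ N s i)

vanishesBelow-qP^ : ∀ N s → VanishesBelow N (qP ^P N ⊗ s)
vanishesBelow-qP^ (suc N) s zero    i<N       = coeff-≡ (qP^-⊗ N s) 0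
vanishesBelow-qP^ (suc N) s (suc i) (s≤s i<N) =
  ≡.trans (coeff-≡ (qP^-⊗ N s) (suc i)) (vanishesBelow-qP^ N s i i<N)

-- Such denominators are units of ℤ[[q]]; they include [k]!, [2] and ([N][N+1])ᵏ for N ≥ 1.
record Fraction : Set where
  constructor fraction
  field
    numer denom          : Poly
    denom-constantTermOne : ConstantTermOne denom
open Fraction public

infix 4 _≈ᶠ_
record _≈ᶠ_ (x y : Fraction) : Set where
  constructor cross
  field cross-≋ : numer x ⊗ denom y ≋ numer y ⊗ denom x
open _≈ᶠ_ public

infixl 6 _+ᶠ_
infixl 7 _*ᶠ_

_+ᶠ_ : Fraction → Fraction → Fraction
x +ᶠ y = fraction (numer x ⊗ denom y ⊕ numer y ⊗ denom x) (denom x ⊗ denom y)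
                  (constantTermOne-⊗ (denom-constantTermOne x) (denom-constantTermOne y))

_*ᶠ_ : Fraction → Fraction → Fraction
x *ᶠ y = fraction (numer x ⊗ numer y) (denom x ⊗ denom y)
                  (constantTermOne-⊗ (denom-constantTermOne x) (denom-constantTermOne y))

-ᶠ_ : Fraction → Fraction
-ᶠ x = fraction (negP (numer x)) (denom x) (denom-constantTermOne x)

ι : Poly → Fraction
ι p = fraction p oneP (constantTermOne refl)

_⁻¹ᶠ : ∀ {d} → ConstantTermOne d → Fraction
_⁻¹ᶠ {d} d₀≡1 = fraction oneP d d₀≡1

private
  module Identities where
    trans-lhs : ∀ a b d e f → (a ⊗ f ⊕ negP (e ⊗ b)) ⊗ d ≋ (a ⊗ d) ⊗ f ⊕ negP ((e ⊗ d) ⊗ b)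
    trans-lhs = solve-∀ polyACR
    trans-rhs : ∀ b c f → (c ⊗ b) ⊗ f ⊕ negP ((c ⊗ f) ⊗ b) ≋ []
    trans-rhs = solve-∀ polyACR
    +-cong-lhs : ∀ a b c d b′ d′ → (a ⊗ d ⊕ c ⊗ b) ⊗ (b′ ⊗ d′) ≋ (a ⊗ b′) ⊗ (d ⊗ d′) ⊕ (c ⊗ d′) ⊗ (b ⊗ b′)
    +-cong-lhs = solve-∀ polyACR
    +-cong-rhs : ∀ a b c d b′ d′ → (a ⊗ d ⊕ c ⊗ b) ⊗ (b′ ⊗ d′) ≋ (a ⊗ b′) ⊗ (d′ ⊗ d) ⊕ (c ⊗ d′) ⊗ (b′ ⊗ b)
    +-cong-rhs = solve-∀ polyACR
    *-cong-lhs : ∀ a b c d b′ d′ → (a ⊗ c) ⊗ (b′ ⊗ d′) ≋ (a ⊗ b′) ⊗ (c ⊗ d′)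
    *-cong-lhs = solve-∀ polyACR
    -‿cong′ : ∀ a b → negP a ⊗ b ≋ negP (a ⊗ b)
    -‿cong′ = solve-∀ polyACR
    +-assoc′ : ∀ a b c d e f → ((a ⊗ d ⊕ c ⊗ b) ⊗ f ⊕ e ⊗ (b ⊗ d)) ⊗ (b ⊗ (d ⊗ f)) ≋ (a ⊗ (d ⊗ f) ⊕ (c ⊗ f ⊕ e ⊗ d) ⊗ b) ⊗ ((b ⊗ d) ⊗ f)
    +-assoc′ = solve-∀ polyACR
    +-comm′ : ∀ a b c d → (a ⊗ d ⊕ c ⊗ b) ⊗ (d ⊗ b) ≋ (c ⊗ b ⊕ a ⊗ d) ⊗ (b ⊗ d)
    +-comm′ = solve-∀ polyACR
    +-identityˡ′ : ∀ a b → ([] ⊗ b ⊕ a ⊗ oneP) ⊗ b ≋ a ⊗ (oneP ⊗ b)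
    +-identityˡ′ = solve-∀ polyACR
    +-identityʳ′ : ∀ a b → (a ⊗ oneP ⊕ [] ⊗ b) ⊗ b ≋ a ⊗ (b ⊗ oneP)
    +-identityʳ′ = solve-∀ polyACR
    -‿inverseˡ′ : ∀ a b → (negP a ⊗ b ⊕ a ⊗ b) ⊗ oneP ≋ [] ⊗ (b ⊗ b)
    -‿inverseˡ′ = solve-∀ polyACR
    -‿inverseʳ′ : ∀ a b → (a ⊗ b ⊕ negP a ⊗ b) ⊗ oneP ≋ [] ⊗ (b ⊗ b)
    -‿inverseʳ′ = solve-∀ polyACR
    *-assoc′ : ∀ a b c d e f → ((a ⊗ c) ⊗ e) ⊗ (b ⊗ (d ⊗ f)) ≋ (a ⊗ (c ⊗ e)) ⊗ ((b ⊗ d) ⊗ f)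
    *-assoc′ = solve-∀ polyACR
    *-comm′ : ∀ a b c d → (a ⊗ c) ⊗ (d ⊗ b) ≋ (c ⊗ a) ⊗ (b ⊗ d)
    *-comm′ = solve-∀ polyACR
    *-identityˡ′ : ∀ a b → (oneP ⊗ a) ⊗ b ≋ a ⊗ (oneP ⊗ b)
    *-identityˡ′ = solve-∀ polyACR
    *-identityʳ′ : ∀ a b → (a ⊗ oneP) ⊗ b ≋ a ⊗ (b ⊗ oneP)
    *-identityʳ′ = solve-∀ polyACR
    distribˡ′ : ∀ a b c d e f → (a ⊗ (c ⊗ f ⊕ e ⊗ d)) ⊗ ((b ⊗ d) ⊗ (b ⊗ f)) ≋ ((a ⊗ c) ⊗ (b ⊗ f) ⊕ (a ⊗ e) ⊗ (b ⊗ d)) ⊗ (b ⊗ (d ⊗ f))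
    distribˡ′ = solve-∀ polyACR
    distribʳ′ : ∀ a b c d e f → ((c ⊗ f ⊕ e ⊗ d) ⊗ a) ⊗ ((d ⊗ b) ⊗ (f ⊗ b)) ≋ ((c ⊗ a) ⊗ (f ⊗ b) ⊕ (e ⊗ a) ⊗ (d ⊗ b)) ⊗ ((d ⊗ f) ⊗ b)
    distribʳ′ = solve-∀ polyACR
    ι-+′ : ∀ a b → (a ⊕ b) ⊗ (oneP ⊗ oneP) ≋ (a ⊗ oneP ⊕ b ⊗ oneP) ⊗ oneP
    ι-+′ = solve-∀ polyACR
    ι-*′ : ∀ a b → (a ⊗ b) ⊗ (oneP ⊗ oneP) ≋ (a ⊗ b) ⊗ oneP
    ι-*′ = solve-∀ polyACR
    ⁻¹ᶠ-inverse′ : ∀ s → (s ⊗ oneP) ⊗ oneP ≋ oneP ⊗ (oneP ⊗ s)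
    ⁻¹ᶠ-inverse′ = solve-∀ polyACR
open Identities

≈ᶠ-refl : ∀ {x} → x ≈ᶠ x
≈ᶠ-refl = cross ≋-refl

≈ᶠ-reflexive : ∀ {x y} → x ≡ y → x ≈ᶠ y
≈ᶠ-reflexive refl = ≈ᶠ-refl

≈ᶠ-sym : ∀ {x y} → x ≈ᶠ y → y ≈ᶠ x
≈ᶠ-sym (cross h) = cross (≋-sym h)

-- Cross-multiply through the middle denominator d, which is then cancelled.
≈ᶠ-trans : ∀ {x y z} → x ≈ᶠ y → y ≈ᶠ z → x ≈ᶠ z
≈ᶠ-trans {fraction a b _} {fraction c d d₀≡1} {fraction e f _} (cross ad≋cb) (cross cf≋ed) =
  cross (x-y≋[]⇒x≋y _ _ (≋[]-cancel _ d₀≡1 (begin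
    (a ⊗ f ⊕ negP (e ⊗ b)) ⊗ d            ≈⟨ trans-lhs a b d e f ⟩
    (a ⊗ d) ⊗ f ⊕ negP ((e ⊗ d) ⊗ b)      ≈⟨ ⊕-cong (⊗-congʳ f ad≋cb) (negP-cong (⊗-congʳ b (≋-sym cf≋ed))) ⟩
    (c ⊗ b) ⊗ f ⊕ negP ((c ⊗ f) ⊗ b)      ≈⟨ trans-rhs b c f ⟩
    []                                    ∎)))
  where open ≋-Reasoning

+ᶠ-cong : ∀ {x x′ y y′} → x ≈ᶠ x′ → y ≈ᶠ y′ → x +ᶠ y ≈ᶠ x′ +ᶠ y′
+ᶠ-cong {fraction a b _} {fraction a′ b′ _} {fraction c d _} {fraction c′ d′ _} (cross h) (cross g) =
  cross (begin
    (a ⊗ d ⊕ c ⊗ b) ⊗ (b′ ⊗ d′)                  ≈⟨ +-cong-lhs a b c d b′ d′ ⟩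
    (a ⊗ b′) ⊗ (d ⊗ d′) ⊕ (c ⊗ d′) ⊗ (b ⊗ b′)    ≈⟨ ⊕-cong (⊗-congʳ _ h) (⊗-congʳ _ g) ⟩
    (a′ ⊗ b) ⊗ (d ⊗ d′) ⊕ (c′ ⊗ d) ⊗ (b ⊗ b′)    ≈⟨ +-cong-rhs a′ b′ c′ d′ b d ⟨
    (a′ ⊗ d′ ⊕ c′ ⊗ b′) ⊗ (b ⊗ d)                ∎)
  where open ≋-Reasoning

*ᶠ-cong : ∀ {x x′ y y′} → x ≈ᶠ x′ → y ≈ᶠ y′ → x *ᶠ y ≈ᶠ x′ *ᶠ y′
*ᶠ-cong {fraction a b _} {fraction a′ b′ _} {fraction c d _} {fraction c′ d′ _} (cross h) (cross g) =
  cross (begin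
    (a ⊗ c) ⊗ (b′ ⊗ d′)     ≈⟨ *-cong-lhs a b c d b′ d′ ⟩
    (a ⊗ b′) ⊗ (c ⊗ d′)     ≈⟨ ⊗-cong h g ⟩
    (a′ ⊗ b) ⊗ (c′ ⊗ d)     ≈⟨ *-cong-lhs a′ b′ c′ d′ b d ⟨
    (a′ ⊗ c′) ⊗ (b ⊗ d)     ∎)
  where open ≋-Reasoning

-ᶠ-cong : ∀ {x y} → x ≈ᶠ y → -ᶠ x ≈ᶠ -ᶠ y
-ᶠ-cong {fraction a b _} {fraction c d _} (cross h) =
  cross (≋-trans (-‿cong′ a d) (≋-trans (negP-cong h) (≋-sym (-‿cong′ c b))))

+ᶠ-congˡ : ∀ x {y y′} → y ≈ᶠ y′ → x +ᶠ y ≈ᶠ x +ᶠ y′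
+ᶠ-congˡ x = +ᶠ-cong {x} ≈ᶠ-refl

+ᶠ-congʳ : ∀ y {x x′} → x ≈ᶠ x′ → x +ᶠ y ≈ᶠ x′ +ᶠ y
+ᶠ-congʳ y h = +ᶠ-cong h (≈ᶠ-refl {y})

*ᶠ-congˡ : ∀ x {y y′} → y ≈ᶠ y′ → x *ᶠ y ≈ᶠ x *ᶠ y′
*ᶠ-congˡ x = *ᶠ-cong {x} ≈ᶠ-refl

*ᶠ-congʳ : ∀ y {x x′} → x ≈ᶠ x′ → x *ᶠ y ≈ᶠ x′ *ᶠ y
*ᶠ-congʳ y h = *ᶠ-cong h (≈ᶠ-refl {y})

fracRing : CommutativeRing 0ℓ 0ℓ
fracRing = record
  { Carrier = Fraction ; _≈_ = _≈ᶠ_ ; _+_ = _+ᶠ_ ; _*_ = _*ᶠ_ ; -_ = -ᶠ_ ; 0# = ι [] ; 1# = ι oneP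
  ; isCommutativeRing = record
    { isRing = record
      { +-isAbelianGroup = record
        { isGroup = record
          { isMonoid = record
            { isSemigroup = record
              { isMagma = record
                { isEquivalence = record { refl = ≈ᶠ-refl ; sym = ≈ᶠ-sym ; trans = ≈ᶠ-trans }
                ; ∙-cong = +ᶠ-cong }
              ; assoc = λ x y z → cross (+-assoc′ (numer x) (denom x) (numer y) (denom y) (numer z) (denom z)) }
            ; identity = (λ x → cross (+-identityˡ′ (numer x) (denom x)))
                       , (λ x → cross (+-identityʳ′ (numer x) (denom x))) }
          ; inverse = (λ x → cross (-‿inverseˡ′ (numer x) (denom x)))
                    , (λ x → cross (-‿inverseʳ′ (numer x) (denom x)))
          ; ⁻¹-cong = -ᶠ-cong }
        ; comm = λ x y → cross (+-comm′ (numer x) (denom x) (numer y) (denom y)) }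
      ; *-cong = *ᶠ-cong
      ; *-assoc = λ x y z → cross (*-assoc′ (numer x) (denom x) (numer y) (denom y) (numer z) (denom z))
      ; *-identity = (λ x → cross (*-identityˡ′ (numer x) (denom x)))
                   , (λ x → cross (*-identityʳ′ (numer x) (denom x)))
      ; distrib = (λ x y z → cross (distribˡ′ (numer x) (denom x) (numer y) (denom y) (numer z) (denom z)))
                , (λ x y z → cross (distribʳ′ (numer x) (denom x) (numer y) (denom y) (numer z) (denom z))) }
    ; *-comm = λ x y → cross (*-comm′ (numer x) (denom x) (numer y) (denom y)) } }

≟0ᶠ : (x : Fraction) → Maybe (ι [] ≈ᶠ x)
≟0ᶠ (fraction a d _) with ≟[] a
... | just []≋a = just (cross (≋-trans (⊗-zeroˡ-≋ d ≋-refl) (≋-trans []≋a (≋-sym (⊗-identityʳ a)))))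
... | nothing   = nothing

fracACR : ACR.AlmostCommutativeRing 0ℓ 0ℓ
fracACR = ACR.fromCommutativeRing fracRing ≟0ᶠ

open CommSemigroupProperties (CommutativeRing.*-commutativeSemigroup fracRing) public
  using () renaming (x∙yz≈y∙xz to *ᶠ-x∙yz≈y∙xz)

module ≈ᶠ-Reasoning = SetoidReasoning (CommutativeRing.setoid fracRing)

ι-cong : ∀ {p r} → p ≋ r → ι p ≈ᶠ ι r
ι-cong h = cross (⊗-congʳ oneP h)

ι-+ : ∀ p r → ι (p ⊕ r) ≈ᶠ ι p +ᶠ ι r
ι-+ p r = cross (ι-+′ p r)

ι-* : ∀ p r → ι (p ⊗ r) ≈ᶠ ι p *ᶠ ι r
ι-* p r = cross (ι-*′ p r)

⁻¹ᶠ-inverse : ∀ {d} (d₀≡1 : ConstantTermOne d) → ι d *ᶠ d₀≡1 ⁻¹ᶠ ≈ᶠ ι oneP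
⁻¹ᶠ-inverse {d} d₀≡1 = cross (⁻¹ᶠ-inverse′ d)

qP^-cancel : ∀ N y → ι (qP ^P N) *ᶠ y ≈ᶠ ι [] → y ≈ᶠ ι []
qP^-cancel N (fraction s e _) (cross h) = cross (≋-trans (⊗-identityʳ s) (coeffwise λ i → begin
  coeff s i                        ≡⟨ coeff-qP^-⊗ N s i ⟨
  coeff (qP ^P N ⊗ s) (N ℕ.+ i)    ≡⟨ coeff-≡ (⊗-identityʳ (qP ^P N ⊗ s)) (N ℕ.+ i) ⟨
  coeff ((qP ^P N ⊗ s) ⊗ oneP) (N ℕ.+ i) ≡⟨ coeff-≡ h (N ℕ.+ i) ⟩
  + 0                              ∎))
  where open ≡.≡-Reasoning

q-adicallyZero : ∀ x → (∀ N → Σ[ y ∈ Fraction ] x ≈ᶠ ι (qP ^P suc N) *ᶠ y) → x ≈ᶠ ι []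
q-adicallyZero (fraction a d _) divisible =
  cross (≋-trans (⊗-identityʳ a) (coeffwise λ N → coeff-vanishes N (divisible N)))
  where
  coeff-vanishes : ∀ N → Σ[ y ∈ Fraction ] fraction a d _ ≈ᶠ ι (qP ^P suc N) *ᶠ y → coeff a N ≡ + 0
  coeff-vanishes N (fraction s e e₀≡1 , cross h) =
    vanishesBelow-cancel (suc N) a (constantTermOne-⊗ (denom-constantTermOne (ι oneP)) e₀≡1)
      (λ i i<N → ≡.trans (coeff-≡ (≋-trans h (⊗-assoc (qP ^P suc N) s d)) i) (vanishesBelow-qP^ (suc N) (s ⊗ d) i i<N))
      N ℕ.≤-refl

toFrac : Fraction → Frac
toFrac x = numer x / denom x

≈ᶠ⇒≃F : ∀ {x y} → x ≈ᶠ y → toFrac x ≃F toFrac y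
≈ᶠ⇒≃F (cross h) = ≋⇒≈P h

≃F⇒≈ᶠ : ∀ {x y} → toFrac x ≃F toFrac y → x ≈ᶠ y
≃F⇒≈ᶠ h = cross (≈P⇒≋ h)

open RangeSum fracRing

toFrac-∑ : ∀ n {f g} → (∀ i → toFrac (f i) ≡ g i) → toFrac (∑ n f) ≡ sumF n g
toFrac-∑ zero    h = refl
toFrac-∑ (suc n) h = ≡.cong₂ _⊕F_ (toFrac-∑ n h) (h n)

-- q-integers

open ExpProperties (CommutativeRing.commutativeSemiring polyRing) using (_^_; ^-homo-*; ^-assocʳ; ^-distrib-*; ^-congˡ)

sumP≡∑ : ∀ n f → sumP n f ≡ ∑ₚ n f
sumP≡∑ zero    f = ≡.refl
sumP≡∑ (suc n) f = ≡.cong (_⊕ f n) (sumP≡∑ n f)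

^P≡^ : ∀ p n → p ^P n ≡ p ^ n
^P≡^ p zero    = ≡.refl
^P≡^ p (suc n) = ≡.cong (p ⊗_) (^P≡^ p n)

^P-homo-⊗ : ∀ p m n → p ^P (m ℕ.+ n) ≋ p ^P m ⊗ p ^P n
^P-homo-⊗ p m n rewrite ^P≡^ p (m ℕ.+ n) | ^P≡^ p m | ^P≡^ p n = ^-homo-* p m n

^P-assoc : ∀ p m n → p ^P (m ℕ.* n) ≋ (p ^P m) ^P n
^P-assoc p m n rewrite ^P≡^ p (m ℕ.* n) | ^P≡^ (p ^P m) n | ^P≡^ p m = ≋-sym (^-assocʳ p m n)

^P-distrib-⊗ : ∀ p r n → (p ⊗ r) ^P n ≋ p ^P n ⊗ r ^P n
^P-distrib-⊗ p r n rewrite ^P≡^ (p ⊗ r) n | ^P≡^ p n | ^P≡^ r n = ^-distrib-* p r n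

^P-cong : ∀ {p r} n → p ≋ r → p ^P n ≋ r ^P n
^P-cong {p} {r} n h rewrite ^P≡^ p n | ^P≡^ r n = ^-congˡ n h

qint-suc : ∀ n → qint (suc n) ≋ oneP ⊕ qP ⊗ qint n
qint-suc n = begin
  sumP (suc n) (qP ^P_)                     ≡⟨ sumP≡∑ (suc n) (qP ^P_) ⟩
  ∑ₚ (suc n) (qP ^P_)                        ≈⟨ ∑ₚ-head n (qP ^P_) ⟩
  oneP ⊕ ∑ₚ n (λ i → qP ⊗ qP ^P i)           ≈⟨ ⊕-congˡ oneP (*-distribˡ-∑ₚ n qP (qP ^P_)) ⟨
  oneP ⊕ qP ⊗ ∑ₚ n (qP ^P_)                  ≡⟨ ≡.cong (λ s → oneP ⊕ qP ⊗ s) (sumP≡∑ n (qP ^P_)) ⟨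
  oneP ⊕ qP ⊗ qint n                        ∎
  where open ≋-Reasoning

qint-+ : ∀ m n → qint (m ℕ.+ n) ≋ qint m ⊕ qP ^P m ⊗ qint n
qint-+ zero    n = ≋-sym (⊗-identityˡ (qint n))
qint-+ (suc m) n = begin
  qint (suc (m ℕ.+ n))                            ≈⟨ qint-suc (m ℕ.+ n) ⟩
  oneP ⊕ qP ⊗ qint (m ℕ.+ n)                      ≈⟨ ⊕-congˡ oneP (⊗-congˡ qP (qint-+ m n)) ⟩
  oneP ⊕ qP ⊗ (qint m ⊕ qP ^P m ⊗ qint n)         ≈⟨ regroup qP (qint m) (qP ^P m) (qint n) ⟩
  (oneP ⊕ qP ⊗ qint m) ⊕ (qP ⊗ qP ^P m) ⊗ qint n  ≈⟨ ⊕-congʳ (qP ^P suc m ⊗ qint n) (qint-suc m) ⟨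
  qint (suc m) ⊕ qP ^P suc m ⊗ qint n             ∎
  where
  open ≋-Reasoning
  regroup : ∀ q a b c → oneP ⊕ q ⊗ (a ⊕ b ⊗ c) ≋ (oneP ⊕ q ⊗ a) ⊕ (q ⊗ b) ⊗ c
  regroup = solve-∀ polyACR

qint-double : ∀ n → qint (2 ℕ.* n) ≋ qint n ⊗ (oneP ⊕ qP ^P n)
qint-double n = begin
  qint (n ℕ.+ (n ℕ.+ 0))           ≡⟨ ≡.cong (λ m → qint (n ℕ.+ m)) (ℕ.+-identityʳ n) ⟩
  qint (n ℕ.+ n)                   ≈⟨ qint-+ n n ⟩
  qint n ⊕ qP ^P n ⊗ qint n        ≈⟨ factor (qint n) (qP ^P n) ⟩
  qint n ⊗ (oneP ⊕ qP ^P n)        ∎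
  where
  open ≋-Reasoning
  factor : ∀ a b → a ⊕ b ⊗ a ≋ a ⊗ (oneP ⊕ b)
  factor = solve-∀ polyACR

qP^-via-qint : ∀ n → qP ^P n ≋ oneP ⊕ (qP ⊕ negP oneP) ⊗ qint n
qP^-via-qint zero    = ≋-sym (≋-trans (⊕-congˡ oneP (⊗-zeroʳ (qP ⊕ negP oneP))) (⊕-identityʳ oneP))
qP^-via-qint (suc n) = begin
  qP ⊗ qP ^P n                                           ≈⟨ ⊗-congˡ qP (qP^-via-qint n) ⟩
  qP ⊗ (oneP ⊕ (qP ⊕ negP oneP) ⊗ qint n)                ≈⟨ telescope qP (qint n) ⟩
  oneP ⊕ (qP ⊕ negP oneP) ⊗ (oneP ⊕ qP ⊗ qint n)         ≈⟨ ⊕-congˡ oneP (⊗-congˡ (qP ⊕ negP oneP) (qint-suc n)) ⟨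
  oneP ⊕ (qP ⊕ negP oneP) ⊗ qint (suc n)                 ∎
  where
  open ≋-Reasoning
  telescope : ∀ q a → q ⊗ (oneP ⊕ (q ⊕ negP oneP) ⊗ a) ≋ oneP ⊕ (q ⊕ negP oneP) ⊗ (oneP ⊕ q ⊗ a)
  telescope = solve-∀ polyACR

constantTermOne-resp : ∀ {p r} → p ≋ r → ConstantTermOne p → ConstantTermOne r
constantTermOne-resp h p₀≡1 = constantTermOne (≡.trans (≡.sym (coeff-≡ h 0)) (coeff₀≡1 p₀≡1))

constantTermOne-qint : ∀ n → ConstantTermOne (qint (suc n))
constantTermOne-qint n = constantTermOne-resp (≋-sym (qint-suc n)) (constantTermOne
  (≡.trans (coeff-⊕ oneP (qP ⊗ qint n) 0) (≡.cong₂ ℤ._+_ (≡.refl {x = + 1}) (coeff-≡ (qP-⊗ (qint n)) 0))))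

constantTermOne-qfact : ∀ n → ConstantTermOne (qfact n)
constantTermOne-qfact zero    = constantTermOne ≡.refl
constantTermOne-qfact (suc n) = constantTermOne-⊗ (constantTermOne-qfact n) (constantTermOne-qint n)

constantTermOne-^P : ∀ {p} n → ConstantTermOne p → ConstantTermOne (p ^P n)
constantTermOne-^P zero    p₀≡1 = constantTermOne ≡.refl
constantTermOne-^P (suc n) p₀≡1 = constantTermOne-⊗ p₀≡1 (constantTermOne-^P n p₀≡1)

-- Complete homogeneous symmetric polynomials

hSym-∷ : ∀ j x xs → hSym j (x ∷ xs) ≡ ∑ₚ (suc j) (λ i → x ^P i ⊗ hSym (j ∸ i) xs)
hSym-∷ zero    x xs = sumP≡∑ 1 (λ i → x ^P i ⊗ hSym (0 ∸ i) xs)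
hSym-∷ (suc j) x xs = sumP≡∑ (suc (suc j)) (λ i → x ^P i ⊗ hSym (suc j ∸ i) xs)

hSym-0 : ∀ xs → hSym 0 xs ≋ oneP
hSym-0 []       = ≋-refl
hSym-0 (x ∷ xs) = ≋-trans (⊗-identityˡ (hSym 0 xs)) (hSym-0 xs)

hSym-suc-∷ : ∀ j x xs → hSym (suc j) (x ∷ xs) ≋ hSym (suc j) xs ⊕ x ⊗ hSym j (x ∷ xs)
hSym-suc-∷ j x xs = begin
  hSym (suc j) (x ∷ xs)                                            ≡⟨ hSym-∷ (suc j) x xs ⟩
  ∑ₚ (suc (suc j)) (λ i → x ^P i ⊗ hSym (suc j ∸ i) xs)             ≈⟨ ∑ₚ-head (suc j) (λ i → x ^P i ⊗ hSym (suc j ∸ i) xs) ⟩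
  oneP ⊗ hSym (suc j) xs ⊕ ∑ₚ (suc j) (λ i → (x ⊗ x ^P i) ⊗ hSym (j ∸ i) xs)
    ≈⟨ ⊕-cong (⊗-identityˡ (hSym (suc j) xs)) (∑ₚ-cong (suc j) λ i _ → ⊗-assoc x (x ^P i) (hSym (j ∸ i) xs)) ⟩
  hSym (suc j) xs ⊕ ∑ₚ (suc j) (λ i → x ⊗ (x ^P i ⊗ hSym (j ∸ i) xs))
    ≈⟨ ⊕-congˡ (hSym (suc j) xs) (*-distribˡ-∑ₚ (suc j) x (λ i → x ^P i ⊗ hSym (j ∸ i) xs)) ⟨
  hSym (suc j) xs ⊕ x ⊗ ∑ₚ (suc j) (λ i → x ^P i ⊗ hSym (j ∸ i) xs) ≡⟨ ≡.cong (λ h → hSym (suc j) xs ⊕ x ⊗ h) (hSym-∷ j x xs) ⟨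
  hSym (suc j) xs ⊕ x ⊗ hSym j (x ∷ xs)                            ∎
  where open ≋-Reasoning

hSym-congˡ : ∀ x {xs ys} → (∀ j → hSym j xs ≋ hSym j ys) → ∀ j → hSym j (x ∷ xs) ≋ hSym j (x ∷ ys)
hSym-congˡ x {xs} {ys} h j = begin
  hSym j (x ∷ xs)                                   ≡⟨ hSym-∷ j x xs ⟩
  ∑ₚ (suc j) (λ i → x ^P i ⊗ hSym (j ∸ i) xs)        ≈⟨ ∑ₚ-cong (suc j) (λ i _ → ⊗-congˡ (x ^P i) (h (j ∸ i))) ⟩
  ∑ₚ (suc j) (λ i → x ^P i ⊗ hSym (j ∸ i) ys)        ≡⟨ hSym-∷ j x ys ⟨
  hSym j (x ∷ ys)                                   ∎
  where open ≋-Reasoning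

hSym-suc-∷∷ : ∀ j x y zs → hSym (suc j) (x ∷ y ∷ zs) ≋ hSym (suc j) (x ∷ zs) ⊕ y ⊗ hSym j (x ∷ y ∷ zs)
hSym-suc-∷∷ zero x y zs = begin
  hSym 1 (x ∷ y ∷ zs)                                ≈⟨ hSym-suc-∷ 0 x (y ∷ zs) ⟩
  hSym 1 (y ∷ zs) ⊕ x ⊗ hSym 0 (x ∷ y ∷ zs)          ≈⟨ ⊕-cong (hSym-suc-∷ 0 y zs) (⊗-congˡ x (hSym-0 (x ∷ y ∷ zs))) ⟩
  (hSym 1 zs ⊕ y ⊗ hSym 0 (y ∷ zs)) ⊕ x ⊗ oneP      ≈⟨ ⊕-congʳ (x ⊗ oneP) (⊕-congˡ (hSym 1 zs) (⊗-congˡ y (hSym-0 (y ∷ zs)))) ⟩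
  (hSym 1 zs ⊕ y ⊗ oneP) ⊕ x ⊗ oneP                  ≈⟨ exchange (hSym 1 zs) y x ⟩
  (hSym 1 zs ⊕ x ⊗ oneP) ⊕ y ⊗ oneP                  ≈⟨ ⊕-cong (⊕-congˡ (hSym 1 zs) (⊗-congˡ x (hSym-0 (x ∷ zs)))) (⊗-congˡ y (hSym-0 (x ∷ y ∷ zs))) ⟨
  (hSym 1 zs ⊕ x ⊗ hSym 0 (x ∷ zs)) ⊕ y ⊗ hSym 0 (x ∷ y ∷ zs)  ≈⟨ ⊕-congʳ (y ⊗ hSym 0 (x ∷ y ∷ zs)) (hSym-suc-∷ 0 x zs) ⟨
  hSym 1 (x ∷ zs) ⊕ y ⊗ hSym 0 (x ∷ y ∷ zs)          ∎
  where
  open ≋-Reasoning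
  exchange : ∀ a b c → (a ⊕ b ⊗ oneP) ⊕ c ⊗ oneP ≋ (a ⊕ c ⊗ oneP) ⊕ b ⊗ oneP
  exchange = solve-∀ polyACR
hSym-suc-∷∷ (suc j) x y zs = begin
  hSym (2 ℕ.+ j) (x ∷ y ∷ zs)                                    ≈⟨ hSym-suc-∷ (suc j) x (y ∷ zs) ⟩
  hSym (2 ℕ.+ j) (y ∷ zs) ⊕ x ⊗ hSym (suc j) (x ∷ y ∷ zs)
    ≈⟨ ⊕-cong (hSym-suc-∷ (suc j) y zs) (⊗-congˡ x (hSym-suc-∷∷ j x y zs)) ⟩
  (hSym (2 ℕ.+ j) zs ⊕ y ⊗ hSym (suc j) (y ∷ zs)) ⊕ x ⊗ (hSym (suc j) (x ∷ zs) ⊕ y ⊗ hSym j (x ∷ y ∷ zs))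
    ≈⟨ exchange (hSym (2 ℕ.+ j) zs) y (hSym (suc j) (y ∷ zs)) x (hSym (suc j) (x ∷ zs)) (hSym j (x ∷ y ∷ zs)) ⟩
  (hSym (2 ℕ.+ j) zs ⊕ x ⊗ hSym (suc j) (x ∷ zs)) ⊕ y ⊗ (hSym (suc j) (y ∷ zs) ⊕ x ⊗ hSym j (x ∷ y ∷ zs))
    ≈⟨ ⊕-cong (hSym-suc-∷ (suc j) x zs) (⊗-congˡ y (hSym-suc-∷ j x (y ∷ zs))) ⟨
  hSym (2 ℕ.+ j) (x ∷ zs) ⊕ y ⊗ hSym (suc j) (x ∷ y ∷ zs)         ∎
  where
  open ≋-Reasoning
  exchange : ∀ a b c d e f → (a ⊕ b ⊗ c) ⊕ d ⊗ (e ⊕ b ⊗ f) ≋ (a ⊕ d ⊗ e) ⊕ b ⊗ (c ⊕ d ⊗ f)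
  exchange = solve-∀ polyACR

hSym-swap : ∀ j x y zs → hSym j (x ∷ y ∷ zs) ≋ hSym j (y ∷ x ∷ zs)
hSym-swap zero    x y zs = ≋-trans (hSym-0 (x ∷ y ∷ zs)) (≋-sym (hSym-0 (y ∷ x ∷ zs)))
hSym-swap (suc j) x y zs = begin
  hSym (suc j) (x ∷ y ∷ zs)                      ≈⟨ hSym-suc-∷∷ j x y zs ⟩
  hSym (suc j) (x ∷ zs) ⊕ y ⊗ hSym j (x ∷ y ∷ zs) ≈⟨ ⊕-congˡ (hSym (suc j) (x ∷ zs)) (⊗-congˡ y (hSym-swap j x y zs)) ⟩
  hSym (suc j) (x ∷ zs) ⊕ y ⊗ hSym j (y ∷ x ∷ zs) ≈⟨ hSym-suc-∷ j y (x ∷ zs) ⟨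
  hSym (suc j) (y ∷ x ∷ zs)                      ∎
  where open ≋-Reasoning

hSym-↭ : ∀ {xs ys} → xs ↭ ys → ∀ j → hSym j xs ≋ hSym j ys
hSym-↭ ↭.refl           j = ≋-refl
hSym-↭ (↭.prep x p)     j = hSym-congˡ x (hSym-↭ p) j
hSym-↭ (↭.swap {xs} x y p) j = ≋-trans (hSym-swap j x y xs) (hSym-congˡ y (hSym-congˡ x (hSym-↭ p)) j)
hSym-↭ (↭.trans p p′)   j = ≋-trans (hSym-↭ p j) (hSym-↭ p′ j)

H : ℕ → ℕ → Poly
H r j = hSym j (vars1q r)

H-0 : ∀ r → H r 0 ≋ oneP
H-0 r = hSym-0 (vars1q r)

H-suc : ∀ r j → H (suc r) j ≋ hSym j (qP ∷ oneP ∷ vars1q r)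
H-suc r = hSym-↭ (↭.prep qP (↭-shift oneP (replicate r qP) (replicate r oneP)))

-- Generating-function form: (1 - z)(1 - q z) ∑ⱼ H (r + 1) j zʲ = ∑ⱼ H r j zʲ.
H-rec : ∀ r j → H (suc r) (2 ℕ.+ j) ≋ H r (2 ℕ.+ j) ⊕ (oneP ⊕ qP) ⊗ H (suc r) (suc j) ⊕ negP (qP ⊗ H (suc r) j)
H-rec r j = begin
  H (suc r) (2 ℕ.+ j)                                         ≈⟨ H-suc r (2 ℕ.+ j) ⟩
  F (2 ℕ.+ j)                                                 ≈⟨ hSym-suc-∷ (suc j) qP (oneP ∷ V) ⟩
  G (2 ℕ.+ j) ⊕ qP ⊗ F (suc j)                                ≈⟨ ⊕-congʳ (qP ⊗ F (suc j)) (hSym-suc-∷ (suc j) oneP V) ⟩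
  (hSym (2 ℕ.+ j) V ⊕ oneP ⊗ G (suc j)) ⊕ qP ⊗ F (suc j)       ≈⟨ ⊕-congʳ (qP ⊗ F (suc j)) (⊕-congˡ (hSym (2 ℕ.+ j) V) (⊗-congˡ oneP G-via-F)) ⟩
  (hSym (2 ℕ.+ j) V ⊕ oneP ⊗ (F (suc j) ⊕ negP (qP ⊗ F j))) ⊕ qP ⊗ F (suc j)
    ≈⟨ collect (hSym (2 ℕ.+ j) V) (F (suc j)) (F j) ⟩
  hSym (2 ℕ.+ j) V ⊕ (oneP ⊕ qP) ⊗ F (suc j) ⊕ negP (qP ⊗ F j)
    ≈⟨ ⊕-cong (⊕-congˡ (H r (2 ℕ.+ j)) (⊗-congˡ (oneP ⊕ qP) (H-suc r (suc j)))) (negP-cong (⊗-congˡ qP (H-suc r j))) ⟨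
  H r (2 ℕ.+ j) ⊕ (oneP ⊕ qP) ⊗ H (suc r) (suc j) ⊕ negP (qP ⊗ H (suc r) j) ∎
  where
  open ≋-Reasoning
  V = vars1q r
  F G : ℕ → Poly
  F j = hSym j (qP ∷ oneP ∷ V)
  G j = hSym j (oneP ∷ V)
  cancelʳ : ∀ g f → g ≋ (g ⊕ qP ⊗ f) ⊕ negP (qP ⊗ f)
  cancelʳ = solve-∀ polyACR
  G-via-F : G (suc j) ≋ F (suc j) ⊕ negP (qP ⊗ F j)
  G-via-F = ≋-trans (cancelʳ (G (suc j)) (F j)) (⊕-congʳ (negP (qP ⊗ F j)) (≋-sym (hSym-suc-∷ j qP (oneP ∷ V))))
  collect : ∀ h f₁ f₀ → (h ⊕ oneP ⊗ (f₁ ⊕ negP (qP ⊗ f₀))) ⊕ qP ⊗ f₁ ≋ h ⊕ (oneP ⊕ qP) ⊗ f₁ ⊕ negP (qP ⊗ f₀)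
  collect = solve-∀ polyACR

H-rec₁ : ∀ r → H (suc r) 1 ≋ H r 1 ⊕ (oneP ⊕ qP) ⊗ H (suc r) 0
H-rec₁ r = begin
  H (suc r) 1                                            ≈⟨ H-suc r 1 ⟩
  hSym 1 (qP ∷ oneP ∷ V)                                 ≈⟨ hSym-suc-∷ 0 qP (oneP ∷ V) ⟩
  hSym 1 (oneP ∷ V) ⊕ qP ⊗ hSym 0 (qP ∷ oneP ∷ V)        ≈⟨ ⊕-cong (hSym-suc-∷ 0 oneP V) (⊗-congˡ qP (hSym-0 (qP ∷ oneP ∷ V))) ⟩
  (H r 1 ⊕ oneP ⊗ hSym 0 (oneP ∷ V)) ⊕ qP ⊗ oneP         ≈⟨ ⊕-congʳ (qP ⊗ oneP) (⊕-congˡ (H r 1) (⊗-congˡ oneP (hSym-0 (oneP ∷ V)))) ⟩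
  (H r 1 ⊕ oneP ⊗ oneP) ⊕ qP ⊗ oneP                      ≈⟨ collect (H r 1) ⟩
  H r 1 ⊕ (oneP ⊕ qP) ⊗ oneP                             ≈⟨ ⊕-congˡ (H r 1) (⊗-congˡ (oneP ⊕ qP) (H-0 (suc r))) ⟨
  H r 1 ⊕ (oneP ⊕ qP) ⊗ H (suc r) 0                      ∎
  where
  open ≋-Reasoning
  V = vars1q r
  collect : ∀ h → (h ⊕ oneP ⊗ oneP) ⊕ qP ⊗ oneP ≋ h ⊕ (oneP ⊕ qP) ⊗ oneP
  collect = solve-∀ polyACR

-- The entries a_{k,m}

≤ᵇ-true : ∀ {m n} → m ≤ n → (m ≤ᵇ n) ≡ true
≤ᵇ-true m≤n = Equivalence.to T-≡ (ℕ.≤⇒≤ᵇ m≤n)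

≤ᵇ-false : ∀ {m n} → n < m → (m ≤ᵇ n) ≡ false
≤ᵇ-false {m} {n} n<m with m ≤ᵇ n | ℕ.≤ᵇ-reflects-≤ m n
... | false | _       = refl
... | true  | ofʸ m≤n = ⊥-elim (ℕ.<⇒≱ n<m m≤n)

aEntry-inside : ∀ {k m} → m ≤ k → k ≤ 2 ℕ.* m → aEntry k m ≡ H (suc (k ∸ m)) (2 ℕ.* m ∸ k)
aEntry-inside m≤k k≤2m rewrite ≤ᵇ-true m≤k | ≤ᵇ-true k≤2m = refl

aEntry-above : ∀ {k m} → k < m → aEntry k m ≡ []
aEntry-above k<m rewrite ≤ᵇ-false k<m = refl

aEntry-beyond : ∀ {k m} → 2 ℕ.* m < k → aEntry k m ≡ []
aEntry-beyond {k} {m} 2m<k rewrite ≤ᵇ-false 2m<k with m ≤ᵇ k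
... | false = refl
... | true  = refl

-- The three regions of index pairs: above the diagonal, the band m ≤ k ≤ 2m where
-- aEntry k m = H (k - m + 1) (2m - k), and beyond it.
data Region : ℕ → ℕ → Set where
  above  : ∀ {k m} → k < m → Region k m
  band   : ∀ d e → Region (e ℕ.+ (d ℕ.+ d)) (e ℕ.+ d)
  beyond : ∀ m x → Region (suc x ℕ.+ (m ℕ.+ m)) m

region : ∀ k m → Region k m
region k m with k ℕ.<? m
... | yes k<m = above k<m
... | no  k≮m with ℕ.m≤n⇒∃[o]m+o≡n (ℕ.≮⇒≥ k≮m)
...   | d , refl with d ℕ.≤? m
...     | yes d≤m with ℕ.m≤n⇒∃[o]m+o≡n d≤m
...       | e , refl = ≡.subst₂ Region (band-k d e) (ℕ.+-comm e d) (band d e)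
  where
  band-k : ∀ d e → e ℕ.+ (d ℕ.+ d) ≡ d ℕ.+ e ℕ.+ d
  band-k = ℕ-Solver.solve-∀
region k m | no k≮m | d , refl | no d≰m with ℕ.m≤n⇒∃[o]m+o≡n (ℕ.≰⇒> d≰m)
... | x , refl = ≡.subst (λ k → Region k m) (beyond-k m x) (beyond m x)
  where
  beyond-k : ∀ m x → suc x ℕ.+ (m ℕ.+ m) ≡ m ℕ.+ (suc m ℕ.+ x)
  beyond-k = ℕ-Solver.solve-∀

aEntry-band : ∀ d e → aEntry (e ℕ.+ (d ℕ.+ d)) (e ℕ.+ d) ≡ H (suc d) e
aEntry-band d e = ≡.trans (aEntry-inside m≤k k≤2m) (≡.cong₂ (λ r j → H (suc r) j) k-m 2m-k)
  where
  m≤k : e ℕ.+ d ≤ e ℕ.+ (d ℕ.+ d)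
  m≤k = ℕ.+-monoʳ-≤ e (ℕ.m≤n+m d d)
  eq : ∀ d e → 2 ℕ.* (e ℕ.+ d) ≡ e ℕ.+ (d ℕ.+ d) ℕ.+ e
  eq = ℕ-Solver.solve-∀
  k≤2m : e ℕ.+ (d ℕ.+ d) ≤ 2 ℕ.* (e ℕ.+ d)
  k≤2m = ≡.subst (e ℕ.+ (d ℕ.+ d) ≤_) (≡.sym (eq d e)) (ℕ.m≤m+n (e ℕ.+ (d ℕ.+ d)) e)
  k-m : e ℕ.+ (d ℕ.+ d) ∸ (e ℕ.+ d) ≡ d
  k-m = ≡.trans (≡.cong (_∸ (e ℕ.+ d)) (≡.sym (ℕ.+-assoc e d d))) (ℕ.m+n∸m≡n (e ℕ.+ d) d)
  2m-k : 2 ℕ.* (e ℕ.+ d) ∸ (e ℕ.+ (d ℕ.+ d)) ≡ e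
  2m-k = ≡.trans (≡.cong (_∸ (e ℕ.+ (d ℕ.+ d))) (eq d e)) (ℕ.m+n∸m≡n (e ℕ.+ (d ℕ.+ d)) e)

aEntry-beyond-region : ∀ m x → aEntry (suc x ℕ.+ (m ℕ.+ m)) m ≡ []
aEntry-beyond-region m x = aEntry-beyond {suc x ℕ.+ (m ℕ.+ m)} {m} (≡.subst (ℕ._< suc x ℕ.+ (m ℕ.+ m)) (eq m) (s≤s (ℕ.m≤n+m (m ℕ.+ m) x)))
  where
  eq : ∀ m → m ℕ.+ m ≡ 2 ℕ.* m
  eq = ℕ-Solver.solve-∀

-- For d = 0 the entry lies above the diagonal and both sides vanish.
aEntry-band-above : ∀ d e → aEntry (e ℕ.+ (d ℕ.+ d)) (suc (e ℕ.+ d)) ≡ H d (2 ℕ.+ e)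
aEntry-band-above zero    e = aEntry-above (ℕ.n<1+n (e ℕ.+ 0))
aEntry-band-above (suc d) e = ≡.trans (≡.cong₂ aEntry (k-eq d e) (m-eq d e)) (aEntry-band d (2 ℕ.+ e))
  where
  k-eq : ∀ d e → e ℕ.+ (suc d ℕ.+ suc d) ≡ 2 ℕ.+ e ℕ.+ (d ℕ.+ d)
  k-eq = ℕ-Solver.solve-∀
  m-eq : ∀ d e → suc (e ℕ.+ suc d) ≡ 2 ℕ.+ e ℕ.+ d
  m-eq = ℕ-Solver.solve-∀

private
  at-row : ∀ m {k k′} → k ≡ k′ → aEntry k m ≡ aEntry k′ m
  at-row m = ≡.cong (λ k → aEntry k m)

  from-values : ∀ {a b c d a′ b′ c′ d′} → a ≡ a′ → b ≡ b′ → c ≡ c′ → d ≡ d′ →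
                a′ ≋ b′ ⊕ (oneP ⊕ qP) ⊗ c′ ⊕ negP (qP ⊗ d′) → a ≋ b ⊕ (oneP ⊕ qP) ⊗ c ⊕ negP (qP ⊗ d)
  from-values refl refl refl refl h = h

  vanishing-term : ∀ b c → b ≋ b ⊕ negP (c ⊗ [])
  vanishing-term = solve-∀ polyACR

  vanishing-terms : ∀ b a c → b ≋ b ⊕ a ⊗ [] ⊕ negP (c ⊗ [])
  vanishing-terms = solve-∀ polyACR

  double-suc : ∀ m → 2 ℕ.+ (m ℕ.+ m) ≡ suc m ℕ.+ suc m
  double-suc = ℕ-Solver.solve-∀

  double-suc-suc : ∀ m → 4 ℕ.+ (m ℕ.+ m) ≡ 2 ℕ.+ m ℕ.+ (2 ℕ.+ m)
  double-suc-suc = ℕ-Solver.solve-∀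

  shift-beyond : ∀ x m → 2 ℕ.+ x ℕ.+ (m ℕ.+ m) ≡ x ℕ.+ (suc m ℕ.+ suc m)
  shift-beyond = ℕ-Solver.solve-∀

-- In the band this is H-rec; just beyond it, it degenerates to H-rec₁ and to H-0.
aEntry-rec : ∀ k m → aEntry (2 ℕ.+ k) (2 ℕ.+ m)
  ≋ aEntry k (suc m) ⊕ (oneP ⊕ qP) ⊗ aEntry (suc k) (suc m) ⊕ negP (qP ⊗ aEntry k m)
aEntry-rec k m with region k m
... | above k<m = from-values (aEntry-above (s≤s (s≤s k<m))) (aEntry-above (ℕ.m<n⇒m<1+n k<m))
                              (aEntry-above (s≤s k<m)) (aEntry-above k<m)
                              (vanishing-terms [] (oneP ⊕ qP) qP)
... | band d e = from-values (aEntry-band d (2 ℕ.+ e)) (aEntry-band-above d e)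
                             (aEntry-band d (suc e)) (aEntry-band d e)
                             (H-rec d e)
... | beyond m zero =
  from-values (≡.trans (at-row (2 ℕ.+ m) (≡.cong suc (double-suc m))) (aEntry-band (suc m) 1))
              (aEntry-band m 1)
              (≡.trans (at-row (suc m) (double-suc m)) (aEntry-band (suc m) 0))
              (aEntry-beyond-region m 0)
              (≋-trans (H-rec₁ (suc m)) (vanishing-term _ qP))
... | beyond m (suc zero) =
  from-values (≡.trans (at-row (2 ℕ.+ m) (double-suc-suc m)) (aEntry-band (2 ℕ.+ m) 0))
              (≡.trans (at-row (suc m) (double-suc m)) (aEntry-band (suc m) 0))
              (≡.trans (at-row (suc m) (≡.cong suc (double-suc m))) (aEntry-beyond-region (suc m) 0))
              (aEntry-beyond-region m 1)
              (≋-trans (≋-trans (H-0 (3 ℕ.+ m)) (≋-sym (H-0 (2 ℕ.+ m)))) (vanishing-terms _ (oneP ⊕ qP) qP))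
... | beyond m (suc (suc y)) =
  from-values (≡.trans (at-row (2 ℕ.+ m) (≡.trans (shift-beyond (3 ℕ.+ y) m) (shift-beyond (1 ℕ.+ y) (suc m))))
                       (aEntry-beyond-region (2 ℕ.+ m) y))
              (≡.trans (at-row (suc m) (shift-beyond (1 ℕ.+ y) m)) (aEntry-beyond-region (suc m) y))
              (≡.trans (at-row (suc m) (shift-beyond (2 ℕ.+ y) m)) (aEntry-beyond-region (suc m) (suc y)))
              (aEntry-beyond-region m (2 ℕ.+ y))
              (vanishing-terms [] (oneP ⊕ qP) qP)

aEntry-rec₁ : ∀ k → aEntry (2 ℕ.+ k) 1 ≋ aEntry k 0 ⊕ (oneP ⊕ qP) ⊗ aEntry (suc k) 0
aEntry-rec₁ zero    = ≋-trans (≋-trans (H-0 2) (≋-sym (H-0 1))) (vanishing-terms′ (H 1 0) (oneP ⊕ qP))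
  where
  vanishing-terms′ : ∀ b a → b ≋ b ⊕ a ⊗ []
  vanishing-terms′ = solve-∀ polyACR
aEntry-rec₁ (suc k)
  rewrite aEntry-beyond {3 ℕ.+ k} {1} (s≤s (s≤s (s≤s z≤n))) | aEntry-beyond {suc k} {0} (s≤s z≤n)
        | aEntry-beyond {2 ℕ.+ k} {0} (s≤s z≤n) = vanishing-terms′ (oneP ⊕ qP)
  where
  vanishing-terms′ : ∀ a → [] ≋ [] ⊕ a ⊗ []
  vanishing-terms′ = solve-∀ polyACR

-- Row generating polynomials of a

open LinearRecurrence polyRing

aTerm : Poly → Poly → ℕ → ℕ → Poly
aTerm t w k m = aEntry k m ⊗ t ^P (k ∸ m) ⊗ w ^P m

R : Poly → Poly → ℕ → Poly
R t w k = ∑ₚ (suc k) (aTerm t w k)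

-- t^{k-m} = t · t^{k-m-1} fails when m ≥ k, but then a_{k,m+1} = 0.
aEntry-t^-pull : ∀ t k m → aEntry k (suc m) ⊗ t ^P (k ∸ m) ≋ t ⊗ (aEntry k (suc m) ⊗ t ^P (k ∸ suc m))
aEntry-t^-pull t k m with m ℕ.<? k
aEntry-t^-pull t (suc k) m | yes (s≤s m≤k) rewrite ℕ.+-∸-assoc 1 m≤k =
  ⊗-x∙yz≈y∙xz (aEntry (suc k) (suc m)) t (t ^P (k ∸ m))
aEntry-t^-pull t k m | no m≮k rewrite aEntry-above {k} {suc m} (s≤s (ℕ.≮⇒≥ m≮k)) = ≋-sym (⊗-zeroʳ t)

aTerm-rec : ∀ t w k m → aTerm t w (2 ℕ.+ k) (2 ℕ.+ m)
  ≋ (t ⊗ w) ⊗ aTerm t w k (suc m) ⊕ ((oneP ⊕ qP) ⊗ w) ⊗ aTerm t w (suc k) (suc m)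
    ⊕ negP ((qP ⊗ w ⊗ w) ⊗ aTerm t w k m)
aTerm-rec t w k m = begin
  aEntry (2 ℕ.+ k) (2 ℕ.+ m) ⊗ τ ⊗ (w ⊗ (w ⊗ W))
    ≈⟨ ⊗-congʳ (w ⊗ (w ⊗ W)) (⊗-congʳ τ (aEntry-rec k m)) ⟩
  (aₖₘ₊₁ ⊕ (oneP ⊕ qP) ⊗ aₖ₊₁ₘ₊₁ ⊕ negP (qP ⊗ aₖₘ)) ⊗ τ ⊗ (w ⊗ (w ⊗ W))
    ≈⟨ expand aₖₘ₊₁ aₖ₊₁ₘ₊₁ aₖₘ τ w W (oneP ⊕ qP) qP ⟩
  (aₖₘ₊₁ ⊗ τ) ⊗ (w ⊗ (w ⊗ W)) ⊕ ((oneP ⊕ qP) ⊗ w) ⊗ (aₖ₊₁ₘ₊₁ ⊗ τ ⊗ (w ⊗ W)) ⊕ negP ((qP ⊗ w ⊗ w) ⊗ (aₖₘ ⊗ τ ⊗ W))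
    ≈⟨ ⊕-congʳ _ (⊕-congʳ _ (⊗-congʳ (w ⊗ (w ⊗ W)) (aEntry-t^-pull t k m))) ⟩
  (t ⊗ (aₖₘ₊₁ ⊗ τ′)) ⊗ (w ⊗ (w ⊗ W)) ⊕ ((oneP ⊕ qP) ⊗ w) ⊗ (aₖ₊₁ₘ₊₁ ⊗ τ ⊗ (w ⊗ W)) ⊕ negP ((qP ⊗ w ⊗ w) ⊗ (aₖₘ ⊗ τ ⊗ W))
    ≈⟨ ⊕-congʳ _ (⊕-congʳ _ (regroup t (aₖₘ₊₁ ⊗ τ′) w W)) ⟩
  (t ⊗ w) ⊗ (aₖₘ₊₁ ⊗ τ′ ⊗ (w ⊗ W)) ⊕ ((oneP ⊕ qP) ⊗ w) ⊗ (aₖ₊₁ₘ₊₁ ⊗ τ ⊗ (w ⊗ W)) ⊕ negP ((qP ⊗ w ⊗ w) ⊗ (aₖₘ ⊗ τ ⊗ W))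
    ∎
  where
  open ≋-Reasoning
  aₖₘ₊₁ = aEntry k (suc m)
  aₖ₊₁ₘ₊₁ = aEntry (suc k) (suc m)
  aₖₘ = aEntry k m
  τ = t ^P (k ∸ m)
  τ′ = t ^P (k ∸ suc m)
  W = w ^P m
  expand : ∀ a₁ a₂ a₃ τ w W c q → (a₁ ⊕ c ⊗ a₂ ⊕ negP (q ⊗ a₃)) ⊗ τ ⊗ (w ⊗ (w ⊗ W))
    ≋ (a₁ ⊗ τ) ⊗ (w ⊗ (w ⊗ W)) ⊕ (c ⊗ w) ⊗ (a₂ ⊗ τ ⊗ (w ⊗ W)) ⊕ negP ((q ⊗ w ⊗ w) ⊗ (a₃ ⊗ τ ⊗ W))
  expand = solve-∀ polyACR
  regroup : ∀ t X w W → (t ⊗ X) ⊗ (w ⊗ (w ⊗ W)) ≋ (t ⊗ w) ⊗ (X ⊗ (w ⊗ W))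
  regroup = solve-∀ polyACR

aTerm-rec₁ : ∀ t w k → aTerm t w (2 ℕ.+ k) 1 ≋ (t ⊗ w) ⊗ aTerm t w k 0 ⊕ ((oneP ⊕ qP) ⊗ w) ⊗ aTerm t w (suc k) 0
aTerm-rec₁ t w k = ≋-trans (⊗-congʳ (w ⊗ oneP) (⊗-congʳ (t ^P suc k) (aEntry-rec₁ k)))
                           (expand (aEntry k 0) (aEntry (suc k) 0) (t ^P k) t w (oneP ⊕ qP))
  where
  expand : ∀ a₀ a₁ τ t w c → (a₀ ⊕ c ⊗ a₁) ⊗ (t ⊗ τ) ⊗ (w ⊗ oneP)
    ≋ (t ⊗ w) ⊗ (a₀ ⊗ τ ⊗ oneP) ⊕ (c ⊗ w) ⊗ (a₁ ⊗ (t ⊗ τ) ⊗ oneP)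
  expand = solve-∀ polyACR

R-head : ∀ t w k → R t w k ≋ aTerm t w k 0 ⊕ ∑ₚ (suc k) (λ m → aTerm t w k (suc m))
R-head t w k = begin
  ∑ₚ (suc k) (aTerm t w k)                                   ≈⟨ ∑ₚ-head k (aTerm t w k) ⟩
  aTerm t w k 0 ⊕ ∑ₚ k (λ m → aTerm t w k (suc m))           ≈⟨ ⊕-congˡ (aTerm t w k 0) (∑ₚ-extend (λ m → aTerm t w k (suc m)) (ℕ.n≤1+n k) past-end) ⟨
  aTerm t w k 0 ⊕ ∑ₚ (suc k) (λ m → aTerm t w k (suc m))     ∎
  where
  open ≋-Reasoning
  past-end : ∀ j → k ℕ.≤ j → j < suc k → aTerm t w k (suc j) ≋ []
  past-end j k≤j _ rewrite aEntry-above {k} {suc j} (s≤s k≤j) = ≋-refl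

R-rec : ∀ t w k → R t w (2 ℕ.+ k)
  ≋ ((oneP ⊕ qP) ⊗ w) ⊗ R t w (suc k) ⊕ negP ((qP ⊗ w ⊗ w ⊕ negP (t ⊗ w)) ⊗ R t w k)
R-rec t w k = begin
  ∑ₚ (3 ℕ.+ k) (T (2 ℕ.+ k))
    ≈⟨ ≋-trans (∑ₚ-head (2 ℕ.+ k) (T (2 ℕ.+ k))) (⊕-congˡ (T (2 ℕ.+ k) 0) (∑ₚ-head (suc k) (λ m → T (2 ℕ.+ k) (suc m)))) ⟩
  T (2 ℕ.+ k) 0 ⊕ (T (2 ℕ.+ k) 1 ⊕ ∑ₚ (suc k) (λ m → T (2 ℕ.+ k) (2 ℕ.+ m)))
    ≈⟨ ⊕-cong row-start (⊕-cong (aTerm-rec₁ t w k) (∑ₚ-cong (suc k) λ m _ → aTerm-rec t w k m)) ⟩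
  [] ⊕ ((tw ⊗ T k 0 ⊕ cw ⊗ T (suc k) 0)
       ⊕ ∑ₚ (suc k) (λ m → tw ⊗ T k (suc m) ⊕ cw ⊗ T (suc k) (suc m) ⊕ negP (qww ⊗ T k m)))
    ≈⟨ ⊕-congˡ [] (⊕-congˡ (tw ⊗ T k 0 ⊕ cw ⊗ T (suc k) 0) (linear (suc k) tw cw qww (λ m → T k (suc m)) (λ m → T (suc k) (suc m)) (T k))) ⟩
  [] ⊕ ((tw ⊗ T k 0 ⊕ cw ⊗ T (suc k) 0)
       ⊕ (tw ⊗ Σ k ⊕ cw ⊗ Σ (suc k) ⊕ negP (qww ⊗ R t w k)))
    ≈⟨ collect tw cw qww (T k 0) (T (suc k) 0) (Σ k) (Σ (suc k)) (R t w k) ⟩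
  cw ⊗ (T (suc k) 0 ⊕ Σ (suc k)) ⊕ negP (qww ⊗ R t w k) ⊕ tw ⊗ (T k 0 ⊕ Σ k)
    ≈⟨ ⊕-cong (⊕-congʳ _ (⊗-congˡ cw (∑ₚ-head (suc k) (T (suc k))))) (⊗-congˡ tw (R-head t w k)) ⟨
  cw ⊗ R t w (suc k) ⊕ negP (qww ⊗ R t w k) ⊕ tw ⊗ R t w k
    ≈⟨ factor cw qww tw (R t w (suc k)) (R t w k) ⟩
  cw ⊗ R t w (suc k) ⊕ negP ((qww ⊕ negP tw) ⊗ R t w k)
    ∎
  where
  open ≋-Reasoning
  T = aTerm t w
  Σ : ℕ → Poly
  Σ j = ∑ₚ (suc k) (λ m → T j (suc m))
  tw = t ⊗ w
  cw = (oneP ⊕ qP) ⊗ w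
  qww = qP ⊗ w ⊗ w
  row-start : T (2 ℕ.+ k) 0 ≋ []
  row-start rewrite aEntry-beyond {2 ℕ.+ k} {0} (s≤s z≤n) = ≋-refl
  linear : ∀ n a b c f g h → ∑ₚ n (λ m → a ⊗ f m ⊕ b ⊗ g m ⊕ negP (c ⊗ h m)) ≋ a ⊗ ∑ₚ n f ⊕ b ⊗ ∑ₚ n g ⊕ negP (c ⊗ ∑ₚ n h)
  linear n a b c f g h = begin
    ∑ₚ n (λ m → a ⊗ f m ⊕ b ⊗ g m ⊕ negP (c ⊗ h m))
      ≈⟨ ≋-trans (∑ₚ-distrib-+ n _ _) (⊕-congʳ _ (∑ₚ-distrib-+ n _ _)) ⟩
    ∑ₚ n (λ m → a ⊗ f m) ⊕ ∑ₚ n (λ m → b ⊗ g m) ⊕ ∑ₚ n (λ m → negP (c ⊗ h m))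
      ≈⟨ ⊕-cong (⊕-cong (*-distribˡ-∑ₚ n a f) (*-distribˡ-∑ₚ n b g))
                (≋-trans (negP-cong (*-distribˡ-∑ₚ n c h)) (≋-sym (∑ₚ-distrib-neg n (λ m → c ⊗ h m)))) ⟨
    a ⊗ ∑ₚ n f ⊕ b ⊗ ∑ₚ n g ⊕ negP (c ⊗ ∑ₚ n h)  ∎
  collect : ∀ tw cw qww T₀ T₁ Σ₀ Σ₁ R₀ → [] ⊕ ((tw ⊗ T₀ ⊕ cw ⊗ T₁) ⊕ (tw ⊗ Σ₀ ⊕ cw ⊗ Σ₁ ⊕ negP (qww ⊗ R₀)))
    ≋ cw ⊗ (T₁ ⊕ Σ₁) ⊕ negP (qww ⊗ R₀) ⊕ tw ⊗ (T₀ ⊕ Σ₀)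
  collect = solve-∀ polyACR
  factor : ∀ cw qww tw R₁ R₀ → cw ⊗ R₁ ⊕ negP (qww ⊗ R₀) ⊕ tw ⊗ R₀ ≋ cw ⊗ R₁ ⊕ negP ((qww ⊕ negP tw) ⊗ R₀)
  factor = solve-∀ polyACR

R-0 : ∀ t w → R t w 0 ≋ oneP
R-0 t w = ≋-trans (⊗-identityʳ _) (≋-trans (⊗-identityʳ _) (H-0 1))

R-1 : ∀ t w → R t w 1 ≋ (oneP ⊕ qP) ⊗ w
R-1 t w = begin
  H 1 1 ⊗ oneP ⊗ (w ⊗ oneP)                      ≈⟨ ⊗-congʳ (w ⊗ oneP) (⊗-congʳ oneP (H-rec₁ 0)) ⟩
  ((oneP ⊕ qP) ⊗ H 1 0) ⊗ oneP ⊗ (w ⊗ oneP)      ≈⟨ ⊗-congʳ (w ⊗ oneP) (⊗-congʳ oneP (⊗-congˡ (oneP ⊕ qP) (H-0 1))) ⟩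
  ((oneP ⊕ qP) ⊗ oneP) ⊗ oneP ⊗ (w ⊗ oneP)       ≈⟨ drop-ones (oneP ⊕ qP) w ⟩
  (oneP ⊕ qP) ⊗ w                                ∎
  where
  open ≋-Reasoning
  drop-ones : ∀ c w → (c ⊗ oneP) ⊗ oneP ⊗ (w ⊗ oneP) ≋ c ⊗ w
  drop-ones = solve-∀ polyACR

power-difference-recurrence : ∀ x y → SolvesRecurrence (x ⊕ y) (x ⊗ y) (λ k → x ^P suc k ⊕ negP (y ^P suc k))
power-difference-recurrence x y k = expand x y (x ^P suc k) (y ^P suc k)
  where
  expand : ∀ x y X Y → x ⊗ (x ⊗ X) ⊕ negP (y ⊗ (y ⊗ Y))
    ≋ (x ⊕ y) ⊗ (x ⊗ X ⊕ negP (y ⊗ Y)) ⊕ negP ((x ⊗ y) ⊗ (X ⊕ negP Y))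
  expand = solve-∀ polyACR

-- With a = 1 + q u and b = u - 1 one has u(a + b) = (1 + q) u² and u² a b = q u⁴ - t u²,
-- so (u a)ᵏ⁺¹ - (u b)ᵏ⁺¹ and u (1 + t) R t u² k solve the same recurrence.
power-difference≈R : ∀ u t → t ≋ oneP ⊕ (qP ⊕ negP oneP) ⊗ u → ∀ k →
  (u ⊗ (oneP ⊕ qP ⊗ u)) ^P suc k ≋ (u ⊗ (u ⊕ negP oneP)) ^P suc k ⊕ (u ⊗ (oneP ⊕ t)) ⊗ R t (u ⊗ u) k
power-difference≈R u t t≋ k = begin
  x ^P suc k                        ≈⟨ split (x ^P suc k) (y ^P suc k) ⟩
  y ^P suc k ⊕ D k                  ≈⟨ ⊕-congˡ (y ^P suc k) (recurrence-unique {α} {β} {D} {E} D-rec E-rec D₀ D₁ k) ⟩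
  y ^P suc k ⊕ E k                  ∎
  where
  open ≋-Reasoning
  x = u ⊗ (oneP ⊕ qP ⊗ u)
  y = u ⊗ (u ⊕ negP oneP)
  w = u ⊗ u
  α = (oneP ⊕ qP) ⊗ w
  β = qP ⊗ w ⊗ w ⊕ negP (t ⊗ w)
  c = u ⊗ (oneP ⊕ t)
  D E : ℕ → Poly
  D k = x ^P suc k ⊕ negP (y ^P suc k)
  E k = c ⊗ R t w k
  split : ∀ X Y → X ≋ Y ⊕ (X ⊕ negP Y)
  split = solve-∀ polyACR
  sum-identity : ∀ u q → u ⊗ (oneP ⊕ q ⊗ u) ⊕ u ⊗ (u ⊕ negP oneP) ≋ (oneP ⊕ q) ⊗ (u ⊗ u)
  sum-identity = solve-∀ polyACR
  product-identity : ∀ u q → (u ⊗ (oneP ⊕ q ⊗ u)) ⊗ (u ⊗ (u ⊕ negP oneP))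
    ≋ q ⊗ (u ⊗ u) ⊗ (u ⊗ u) ⊕ negP ((oneP ⊕ (q ⊕ negP oneP) ⊗ u) ⊗ (u ⊗ u))
  product-identity = solve-∀ polyACR
  difference-identity : ∀ u q → u ⊗ (oneP ⊕ q ⊗ u) ⊕ negP (u ⊗ (u ⊕ negP oneP))
    ≋ u ⊗ (oneP ⊕ (oneP ⊕ (q ⊕ negP oneP) ⊗ u))
  difference-identity = solve-∀ polyACR
  x⊗y≋β : x ⊗ y ≋ β
  x⊗y≋β = ≋-trans (product-identity u qP) (⊕-congˡ (qP ⊗ w ⊗ w) (negP-cong (⊗-congʳ w (≋-sym t≋))))
  x-y≋c : x ⊕ negP y ≋ c
  x-y≋c = ≋-trans (difference-identity u qP) (⊗-congˡ u (⊕-congˡ oneP (≋-sym t≋)))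
  D-rec : SolvesRecurrence α β D
  D-rec = SolvesRecurrence-cong {s = D} (sum-identity u qP) x⊗y≋β (power-difference-recurrence x y)
  scaled : ∀ c α β R₁ R₀ → c ⊗ (α ⊗ R₁ ⊕ negP (β ⊗ R₀)) ≋ α ⊗ (c ⊗ R₁) ⊕ negP (β ⊗ (c ⊗ R₀))
  scaled = solve-∀ polyACR
  E-rec : SolvesRecurrence α β E
  E-rec k = ≋-trans (⊗-congˡ c (R-rec t w k)) (scaled c α β (R t w (suc k)) (R t w k))
  one-power : ∀ x y → x ⊗ oneP ⊕ negP (y ⊗ oneP) ≋ x ⊕ negP y
  one-power = solve-∀ polyACR
  D₀ : D 0 ≋ E 0
  D₀ = ≋-trans (one-power x y) (≋-trans x-y≋c (≋-trans (≋-sym (⊗-identityʳ c)) (⊗-congˡ c (≋-sym (R-0 t w)))))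
  two-power : ∀ x y → x ⊗ (x ⊗ oneP) ⊕ negP (y ⊗ (y ⊗ oneP)) ≋ (x ⊕ y) ⊗ (x ⊕ negP y)
  two-power = solve-∀ polyACR
  D₁ : D 1 ≋ E 1
  D₁ = begin
    x ⊗ (x ⊗ oneP) ⊕ negP (y ⊗ (y ⊗ oneP))   ≈⟨ two-power x y ⟩
    (x ⊕ y) ⊗ (x ⊕ negP y)                   ≈⟨ ⊗-cong (sum-identity u qP) x-y≋c ⟩
    α ⊗ c                                    ≈⟨ ⊗-comm α c ⟩
    c ⊗ α                                    ≈⟨ ⊗-congˡ c (R-1 t w) ⟨
    c ⊗ R t w 1                              ∎

X : ℕ → Poly
X n = qint n ⊗ qint (suc n)

X^-suc : ∀ N k → X (suc N) ^P suc k
  ≋ qP ^P suc k ⊗ X N ^P suc k ⊕ qint (2 ℕ.* suc N) ⊗ R (qP ^P suc N) (qint (suc N) ⊗ qint (suc N)) k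
X^-suc N k = begin
  X (suc N) ^P suc k                                  ≈⟨ ^P-cong (suc k) (⊗-congˡ u (qint-suc (suc N))) ⟩
  (u ⊗ (oneP ⊕ qP ⊗ u)) ^P suc k                      ≈⟨ power-difference≈R u t (qP^-via-qint (suc N)) k ⟩
  (u ⊗ (u ⊕ negP oneP)) ^P suc k ⊕ (u ⊗ (oneP ⊕ t)) ⊗ R t (u ⊗ u) k
    ≈⟨ ⊕-cong (≋-trans (≋-sym (^P-distrib-⊗ qP (X N) (suc k))) (^P-cong (suc k) qX≋))
              (⊗-congʳ (R t (u ⊗ u) k) (qint-double (suc N))) ⟨
  qP ^P suc k ⊗ X N ^P suc k ⊕ qint (2 ℕ.* suc N) ⊗ R t (u ⊗ u) k ∎
  where
  open ≋-Reasoning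
  u = qint (suc N)
  t = qP ^P suc N
  regroup : ∀ q n u → q ⊗ (n ⊗ u) ≋ u ⊗ ((oneP ⊕ q ⊗ n) ⊕ negP oneP)
  regroup = solve-∀ polyACR
  qX≋ : qP ⊗ X N ≋ u ⊗ (u ⊕ negP oneP)
  qX≋ = ≋-trans (regroup qP (qint N) u) (⊗-congˡ u (⊕-congʳ (negP oneP) (≋-sym (qint-suc N))))

-- Inverting the power sums

ι-∑ : ∀ n f → ι (∑ₚ n f) ≈ᶠ ∑ n (λ i → ι (f i))
ι-∑ zero    f = ≈ᶠ-refl
ι-∑ (suc n) f = ≈ᶠ-trans (ι-+ (∑ₚ n f) (f n)) (+ᶠ-congʳ (ι (f n)) (ι-∑ n f))

halfQint : ℕ → Fraction
halfQint k = fraction (qint (2 ℕ.* k)) (qint 2) (constantTermOne-qint 1)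

powerSum : ℕ → ℕ → Fraction
powerSum m N = ∑ N (λ i → halfQint (suc i) *ᶠ ι (qint (suc i) ^P (2 ℕ.* m) ⊗ qP ^P (suc m ℕ.* (N ∸ suc i))))

toFrac-powerSum : ∀ m N → toFrac (powerSum m N) ≡ SOdd m N
toFrac-powerSum m N = toFrac-∑ N (λ i → refl)

∸-suc : ∀ {n i} → i < n → n ∸ i ≡ suc (n ∸ suc i)
∸-suc {suc n} (s≤s i≤n) = ℕ.+-∸-assoc 1 i≤n

powerSum-suc : ∀ m N → powerSum m (suc N) ≈ᶠ ι (qP ^P suc m) *ᶠ powerSum m N +ᶠ halfQint (suc N) *ᶠ ι (qint (suc N) ^P (2 ℕ.* m))
powerSum-suc m N = +ᶠ-cong (≈ᶠ-trans (∑-cong N earlier-term) (≈ᶠ-sym (*-distribˡ-∑ N (ι (qP ^P suc m)) (term N))))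
                    (*ᶠ-congˡ (halfQint (suc N)) (ι-cong last-power))
  where
  U : ℕ → Poly
  U i = qint (suc i) ^P (2 ℕ.* m)
  term : ℕ → ℕ → Fraction
  term N i = halfQint (suc i) *ᶠ ι (U i ⊗ qP ^P (suc m ℕ.* (N ∸ suc i)))
  earlier-power : ∀ i → i < N → U i ⊗ qP ^P (suc m ℕ.* (N ∸ i)) ≋ qP ^P suc m ⊗ (U i ⊗ qP ^P (suc m ℕ.* (N ∸ suc i)))
  earlier-power i i<N = begin
    U i ⊗ qP ^P (suc m ℕ.* (N ∸ i))                          ≡⟨ ≡.cong (λ e → U i ⊗ qP ^P (suc m ℕ.* e)) (∸-suc i<N) ⟩
    U i ⊗ qP ^P (suc m ℕ.* suc (N ∸ suc i))                  ≡⟨ ≡.cong (λ e → U i ⊗ qP ^P e) (ℕ.*-suc (suc m) (N ∸ suc i)) ⟩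
    U i ⊗ qP ^P (suc m ℕ.+ suc m ℕ.* (N ∸ suc i))            ≈⟨ ⊗-congˡ (U i) (^P-homo-⊗ qP (suc m) _) ⟩
    U i ⊗ (qP ^P suc m ⊗ qP ^P (suc m ℕ.* (N ∸ suc i)))      ≈⟨ ⊗-x∙yz≈y∙xz (U i) (qP ^P suc m) _ ⟩
    qP ^P suc m ⊗ (U i ⊗ qP ^P (suc m ℕ.* (N ∸ suc i)))      ∎
    where open ≋-Reasoning
  earlier-term : ∀ i → i < N → term (suc N) i ≈ᶠ ι (qP ^P suc m) *ᶠ term N i
  earlier-term i i<N = ≈ᶠ-trans (*ᶠ-congˡ (halfQint (suc i)) (≈ᶠ-trans (ι-cong (earlier-power i i<N)) (ι-* (qP ^P suc m) V)))
                                (*ᶠ-x∙yz≈y∙xz (halfQint (suc i)) (ι (qP ^P suc m)) (ι V))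
    where V = U i ⊗ qP ^P (suc m ℕ.* (N ∸ suc i))
  last-power : U N ⊗ qP ^P (suc m ℕ.* (N ∸ N)) ≋ U N
  last-power rewrite ℕ.n∸n≡0 N | ℕ.*-zeroʳ m = ⊗-identityʳ (U N)

weight : ℕ → ℕ → ℕ → Fraction
weight N k m = ι (aEntry k m ⊗ qP ^P ((k ∸ m) ℕ.* N))

weight-shift : ∀ N k m → m ≤ k → weight (suc N) k m *ᶠ ι (qP ^P suc m) ≈ᶠ ι (qP ^P suc k) *ᶠ weight N k m
weight-shift N k m m≤k = ≈ᶠ-trans (≈ᶠ-sym (ι-* (aEntry k m ⊗ qP ^P ((k ∸ m) ℕ.* suc N)) (qP ^P suc m))) (≈ᶠ-trans (ι-cong poly-shift) (ι-* (qP ^P suc k) (aEntry k m ⊗ qP ^P ((k ∸ m) ℕ.* N))))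
  where
  d = k ∸ m
  exponent : d ℕ.* suc N ℕ.+ suc m ≡ suc k ℕ.+ d ℕ.* N
  exponent = begin
    d ℕ.* suc N ℕ.+ suc m        ≡⟨ ≡.cong (ℕ._+ suc m) (ℕ.*-suc d N) ⟩
    d ℕ.+ d ℕ.* N ℕ.+ suc m      ≡⟨ rearrange d (d ℕ.* N) m ⟩
    suc (d ℕ.+ m) ℕ.+ d ℕ.* N    ≡⟨ ≡.cong (λ e → suc e ℕ.+ d ℕ.* N) (ℕ.m∸n+n≡m m≤k) ⟩
    suc k ℕ.+ d ℕ.* N            ∎
    where
    open ≡.≡-Reasoning
    rearrange : ∀ d x m → d ℕ.+ x ℕ.+ suc m ≡ suc (d ℕ.+ m) ℕ.+ x
    rearrange = ℕ-Solver.solve-∀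
  poly-shift : aEntry k m ⊗ qP ^P (d ℕ.* suc N) ⊗ qP ^P suc m ≋ qP ^P suc k ⊗ (aEntry k m ⊗ qP ^P (d ℕ.* N))
  poly-shift = begin
    aEntry k m ⊗ qP ^P (d ℕ.* suc N) ⊗ qP ^P suc m         ≈⟨ ⊗-assoc (aEntry k m) _ _ ⟩
    aEntry k m ⊗ (qP ^P (d ℕ.* suc N) ⊗ qP ^P suc m)       ≈⟨ ⊗-congˡ (aEntry k m) (^P-homo-⊗ qP (d ℕ.* suc N) (suc m)) ⟨
    aEntry k m ⊗ qP ^P (d ℕ.* suc N ℕ.+ suc m)             ≡⟨ ≡.cong (λ e → aEntry k m ⊗ qP ^P e) exponent ⟩
    aEntry k m ⊗ qP ^P (suc k ℕ.+ d ℕ.* N)                 ≈⟨ ⊗-congˡ (aEntry k m) (^P-homo-⊗ qP (suc k) (d ℕ.* N)) ⟩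
    aEntry k m ⊗ (qP ^P suc k ⊗ qP ^P (d ℕ.* N))           ≈⟨ ⊗-x∙yz≈y∙xz (aEntry k m) (qP ^P suc k) _ ⟩
    qP ^P suc k ⊗ (aEntry k m ⊗ qP ^P (d ℕ.* N))           ∎
    where open ≋-Reasoning

weight-aTerm : ∀ N k m → weight (suc N) k m *ᶠ ι (qint (suc N) ^P (2 ℕ.* m))
  ≈ᶠ ι (aTerm (qP ^P suc N) (qint (suc N) ⊗ qint (suc N)) k m)
weight-aTerm N k m = ≈ᶠ-trans (≈ᶠ-sym (ι-* (aEntry k m ⊗ qP ^P ((k ∸ m) ℕ.* suc N)) (u ^P (2 ℕ.* m)))) (ι-cong (⊗-cong (⊗-congˡ (aEntry k m) t-power) w-power))
  where
  u = qint (suc N)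
  t-power : qP ^P ((k ∸ m) ℕ.* suc N) ≋ (qP ^P suc N) ^P (k ∸ m)
  t-power = ≋-trans (≋-reflexive (≡.cong (qP ^P_) (ℕ.*-comm (k ∸ m) (suc N)))) (^P-assoc qP (suc N) (k ∸ m))
  w-power : u ^P (2 ℕ.* m) ≋ (u ⊗ u) ^P m
  w-power = ≋-trans (^P-assoc u 2 m) (^P-cong m (⊗-congˡ u (⊗-identityʳ u)))

power-sum-inversion : ∀ N k → ι (qint 2) *ᶠ ∑ (suc k) (λ m → weight N k m *ᶠ powerSum m N) ≈ᶠ ι (X N ^P suc k)
power-sum-inversion zero k = ≈ᶠ-trans (*ᶠ-congˡ (ι (qint 2)) (∑-zero (suc k) λ m _ → zeroʳ (weight 0 k m))) (zeroʳ (ι (qint 2)))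
  where open CommutativeRing fracRing using (zeroʳ)
power-sum-inversion (suc N) k = begin
  ι (qint 2) *ᶠ ∑ (suc k) (λ m → weight (suc N) k m *ᶠ powerSum m (suc N))
    ≈⟨ *ᶠ-congˡ (ι (qint 2)) (∑-cong (suc k) λ m m<1+k → row-term m (ℕ.≤-pred m<1+k)) ⟩
  ι (qint 2) *ᶠ ∑ (suc k) (λ m → Q *ᶠ (weight N k m *ᶠ powerSum m N) +ᶠ h *ᶠ ι (T m))
    ≈⟨ *ᶠ-congˡ (ι (qint 2)) (≈ᶠ-trans (∑-distrib-+ (suc k) (λ m → Q *ᶠ (weight N k m *ᶠ powerSum m N)) (λ m → h *ᶠ ι (T m)))
         (+ᶠ-cong (≈ᶠ-sym (*-distribˡ-∑ (suc k) Q (λ m → weight N k m *ᶠ powerSum m N)))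
                  (≈ᶠ-sym (*-distribˡ-∑ (suc k) h (λ m → ι (T m)))))) ⟩
  ι (qint 2) *ᶠ (Q *ᶠ ∑ (suc k) (λ m → weight N k m *ᶠ powerSum m N) +ᶠ h *ᶠ ∑ (suc k) (λ m → ι (T m)))
    ≈⟨ regroup (ι (qint 2)) Q (∑ (suc k) (λ m → weight N k m *ᶠ powerSum m N)) h (∑ (suc k) (λ m → ι (T m))) ⟩
  Q *ᶠ (ι (qint 2) *ᶠ ∑ (suc k) (λ m → weight N k m *ᶠ powerSum m N)) +ᶠ (ι (qint 2) *ᶠ h) *ᶠ ∑ (suc k) (λ m → ι (T m))
    ≈⟨ +ᶠ-cong (*ᶠ-congˡ Q (power-sum-inversion N k)) (*ᶠ-cong [2]·halfQint (≈ᶠ-sym (ι-∑ (suc k) T))) ⟩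
  Q *ᶠ ι (X N ^P suc k) +ᶠ ι (qint (2 ℕ.* suc N)) *ᶠ ι (R t w k)
    ≈⟨ ≈ᶠ-trans (ι-+ (qP ^P suc k ⊗ X N ^P suc k) (qint (2 ℕ.* suc N) ⊗ R t w k))
                (+ᶠ-cong (ι-* (qP ^P suc k) (X N ^P suc k)) (ι-* (qint (2 ℕ.* suc N)) (R t w k))) ⟨
  ι (qP ^P suc k ⊗ X N ^P suc k ⊕ qint (2 ℕ.* suc N) ⊗ R t w k)
    ≈⟨ ι-cong (X^-suc N k) ⟨
  ι (X (suc N) ^P suc k) ∎
  where
  open ≈ᶠ-Reasoning
  t = qP ^P suc N
  w = qint (suc N) ⊗ qint (suc N)
  T = aTerm t w k
  Q = ι (qP ^P suc k)
  h = halfQint (suc N)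
  regroup : ∀ i Q Σ h Σ′ → i *ᶠ (Q *ᶠ Σ +ᶠ h *ᶠ Σ′) ≈ᶠ Q *ᶠ (i *ᶠ Σ) +ᶠ (i *ᶠ h) *ᶠ Σ′
  regroup = solve-∀ fracACR
  distribute : ∀ W Q′ s h U → W *ᶠ (Q′ *ᶠ s +ᶠ h *ᶠ U) ≈ᶠ (W *ᶠ Q′) *ᶠ s +ᶠ h *ᶠ (W *ᶠ U)
  distribute = solve-∀ fracACR
  [2]·halfQint : ι (qint 2) *ᶠ h ≈ᶠ ι (qint (2 ℕ.* suc N))
  [2]·halfQint = cross (swap (qint 2) (qint (2 ℕ.* suc N)))
    where
    swap : ∀ a b → (a ⊗ b) ⊗ oneP ≋ b ⊗ (oneP ⊗ a)
    swap = solve-∀ polyACR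
  row-term : ∀ m → m ≤ k → weight (suc N) k m *ᶠ powerSum m (suc N) ≈ᶠ Q *ᶠ (weight N k m *ᶠ powerSum m N) +ᶠ h *ᶠ ι (T m)
  row-term m m≤k = begin
    weight (suc N) k m *ᶠ powerSum m (suc N)
      ≈⟨ *ᶠ-congˡ (weight (suc N) k m) (powerSum-suc m N) ⟩
    weight (suc N) k m *ᶠ (ι (qP ^P suc m) *ᶠ powerSum m N +ᶠ h *ᶠ ι (qint (suc N) ^P (2 ℕ.* m)))
      ≈⟨ distribute (weight (suc N) k m) (ι (qP ^P suc m)) (powerSum m N) h (ι (qint (suc N) ^P (2 ℕ.* m))) ⟩
    (weight (suc N) k m *ᶠ ι (qP ^P suc m)) *ᶠ powerSum m N +ᶠ h *ᶠ (weight (suc N) k m *ᶠ ι (qint (suc N) ^P (2 ℕ.* m)))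
      ≈⟨ +ᶠ-cong (*ᶠ-congʳ (powerSum m N) (weight-shift N k m m≤k)) (*ᶠ-congˡ h (weight-aTerm N k m)) ⟩
    (Q *ᶠ weight N k m) *ᶠ powerSum m N +ᶠ h *ᶠ ι (T m)
      ≈⟨ +ᶠ-congʳ (h *ᶠ ι (T m)) (*ᶠ-assoc Q (weight N k m) (powerSum m N)) ⟩
    Q *ᶠ (weight N k m *ᶠ powerSum m N) +ᶠ h *ᶠ ι (T m) ∎
    where open CommutativeRing fracRing using () renaming (*-assoc to *ᶠ-assoc)

-- Expansions in powers of [N][N+1]

constantTermOne-X : ∀ N → ConstantTermOne (X (suc N))
constantTermOne-X N = constantTermOne-⊗ (constantTermOne-qint N) (constantTermOne-qint (suc N))

*ι-cancel : ∀ c {d} → ConstantTermOne d → c *ᶠ ι d ≈ᶠ ι [] → c ≈ᶠ ι []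
*ι-cancel c {d} d₀≡1 c·d≈0 = begin
  c                                ≈⟨ *ᶠ-identityʳ c ⟨
  c *ᶠ ι oneP                      ≈⟨ *ᶠ-congˡ c (⁻¹ᶠ-inverse d₀≡1) ⟨
  c *ᶠ (ι d *ᶠ d₀≡1 ⁻¹ᶠ)           ≈⟨ *ᶠ-assoc c (ι d) (d₀≡1 ⁻¹ᶠ) ⟨
  (c *ᶠ ι d) *ᶠ d₀≡1 ⁻¹ᶠ           ≈⟨ *ᶠ-congʳ (d₀≡1 ⁻¹ᶠ) c·d≈0 ⟩
  ι [] *ᶠ d₀≡1 ⁻¹ᶠ                 ≈⟨ zeroˡ (d₀≡1 ⁻¹ᶠ) ⟩
  ι []                             ∎
  where
  open ≈ᶠ-Reasoning
  open CommutativeRing fracRing using (zeroˡ) renaming (*-identityʳ to *ᶠ-identityʳ; *-assoc to *ᶠ-assoc)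

basis : ℕ → ℕ → ℕ → Fraction
basis N k j = ι (qP ^P ((k ∸ j) ℕ.* N) ⊗ X N ^P suc j)

expansion : (ℕ → Fraction) → ℕ → ℕ → Fraction
expansion c k N = ∑ (suc k) (λ j → c j *ᶠ basis N k j)

expansion-suc : ∀ c k N → expansion c (suc k) N ≈ᶠ ι (qP ^P N) *ᶠ expansion c k N +ᶠ c (suc k) *ᶠ ι (X N ^P (2 ℕ.+ k))
expansion-suc c k N = +ᶠ-cong earlier last
  where
  open ≈ᶠ-Reasoning
  term : ℕ → ℕ → Fraction
  term k j = c j *ᶠ basis N k j
  earlier-poly : ∀ j → j ≤ k → qP ^P ((suc k ∸ j) ℕ.* N) ⊗ X N ^P suc j ≋ qP ^P N ⊗ (qP ^P ((k ∸ j) ℕ.* N) ⊗ X N ^P suc j)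
  earlier-poly j j≤k = ≋-trans (⊗-congʳ (X N ^P suc j)
      (≋-trans (≋-reflexive (≡.cong (λ e → qP ^P (e ℕ.* N)) (ℕ.+-∸-assoc 1 j≤k))) (^P-homo-⊗ qP N ((k ∸ j) ℕ.* N))))
    (⊗-assoc (qP ^P N) _ (X N ^P suc j))
  earlier : ∑ (suc k) (term (suc k)) ≈ᶠ ι (qP ^P N) *ᶠ expansion c k N
  earlier = begin
    ∑ (suc k) (term (suc k))                                ≈⟨ ∑-cong (suc k) (λ j j<1+k → *ᶠ-congˡ (c j)
                                                                 (≈ᶠ-trans (ι-cong (earlier-poly j (ℕ.≤-pred j<1+k))) (ι-* (qP ^P N) _))) ⟩
    ∑ (suc k) (λ j → c j *ᶠ (ι (qP ^P N) *ᶠ basis N k j))    ≈⟨ ∑-cong (suc k) (λ j _ → *ᶠ-x∙yz≈y∙xz (c j) (ι (qP ^P N)) (basis N k j)) ⟩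
    ∑ (suc k) (λ j → ι (qP ^P N) *ᶠ term k j)               ≈⟨ *-distribˡ-∑ (suc k) (ι (qP ^P N)) (term k) ⟨
    ι (qP ^P N) *ᶠ expansion c k N                           ∎
  last : term (suc k) (suc k) ≈ᶠ c (suc k) *ᶠ ι (X N ^P (2 ℕ.+ k))
  last rewrite ℕ.n∸n≡0 k = *ᶠ-congˡ (c (suc k)) (ι-cong (⊗-identityˡ (X N ^P (2 ℕ.+ k))))

isolate-coefficient : ∀ Q E c {d} (d₀≡1 : ConstantTermOne d) → Q *ᶠ E +ᶠ c *ᶠ ι d ≈ᶠ ι [] → c ≈ᶠ Q *ᶠ (-ᶠ E *ᶠ d₀≡1 ⁻¹ᶠ)
isolate-coefficient Q E c {d} d₀≡1 sum≈0 = begin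
  c                                                      ≈⟨ ≈ᶠ-sym (*ᶠ-identityʳ c) ⟩
  c *ᶠ ι oneP                                            ≈⟨ *ᶠ-congˡ c (⁻¹ᶠ-inverse d₀≡1) ⟨
  c *ᶠ (ι d *ᶠ d₀≡1 ⁻¹ᶠ)                                 ≈⟨ expand Q E c (ι d) (d₀≡1 ⁻¹ᶠ) ⟩
  (Q *ᶠ E +ᶠ c *ᶠ ι d) *ᶠ d₀≡1 ⁻¹ᶠ +ᶠ Q *ᶠ (-ᶠ E *ᶠ d₀≡1 ⁻¹ᶠ)
    ≈⟨ +ᶠ-congʳ (Q *ᶠ (-ᶠ E *ᶠ d₀≡1 ⁻¹ᶠ)) (*ᶠ-congʳ (d₀≡1 ⁻¹ᶠ) sum≈0) ⟩
  ι [] *ᶠ d₀≡1 ⁻¹ᶠ +ᶠ Q *ᶠ (-ᶠ E *ᶠ d₀≡1 ⁻¹ᶠ)            ≈⟨ drop (d₀≡1 ⁻¹ᶠ) (Q *ᶠ (-ᶠ E *ᶠ d₀≡1 ⁻¹ᶠ)) ⟩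
  Q *ᶠ (-ᶠ E *ᶠ d₀≡1 ⁻¹ᶠ)                                ∎
  where
  open ≈ᶠ-Reasoning
  open CommutativeRing fracRing using () renaming (*-identityʳ to *ᶠ-identityʳ)
  expand : ∀ Q E c D D⁻¹ → c *ᶠ (D *ᶠ D⁻¹) ≈ᶠ (Q *ᶠ E +ᶠ c *ᶠ D) *ᶠ D⁻¹ +ᶠ Q *ᶠ (-ᶠ E *ᶠ D⁻¹)
  expand = solve-∀ fracACR
  drop : ∀ x y → ι [] *ᶠ x +ᶠ y ≈ᶠ y
  drop = solve-∀ fracACR

module _ (k : ℕ) (c : ℕ → Fraction) (vanishes : ∀ N → expansion c (suc k) (suc N) ≈ᶠ ι []) where

  private
    D : ℕ → Poly
    D N = X (suc N) ^P (2 ℕ.+ k)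

    D-unit : ∀ N → ConstantTermOne (D N)
    D-unit N = constantTermOne-^P (2 ℕ.+ k) (constantTermOne-X N)

    split : ∀ N → ι (qP ^P suc N) *ᶠ expansion c k (suc N) +ᶠ c (suc k) *ᶠ ι (D N) ≈ᶠ ι []
    split N = ≈ᶠ-trans (≈ᶠ-sym (expansion-suc c k (suc N))) (vanishes N)

  top-vanishes : c (suc k) ≈ᶠ ι []
  top-vanishes = q-adicallyZero (c (suc k)) λ N →
    -ᶠ expansion c k (suc N) *ᶠ D-unit N ⁻¹ᶠ , isolate-coefficient (ι (qP ^P suc N)) (expansion c k (suc N)) (c (suc k)) (D-unit N) (split N)

  lower-vanishes : ∀ N → expansion c k (suc N) ≈ᶠ ι []
  lower-vanishes N = qP^-cancel (suc N) (expansion c k (suc N)) (begin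
    Q *ᶠ E                            ≈⟨ pad Q E (ι (D N)) ⟩
    Q *ᶠ E +ᶠ ι [] *ᶠ ι (D N)         ≈⟨ +ᶠ-congˡ (Q *ᶠ E) (*ᶠ-congʳ (ι (D N)) top-vanishes) ⟨
    Q *ᶠ E +ᶠ c (suc k) *ᶠ ι (D N)    ≈⟨ split N ⟩
    ι []                              ∎)
    where
    open ≈ᶠ-Reasoning
    Q = ι (qP ^P suc N)
    E = expansion c k (suc N)
    pad : ∀ Q E D → Q *ᶠ E ≈ᶠ Q *ᶠ E +ᶠ ι [] *ᶠ D
    pad = solve-∀ fracACR

-- Since q is not a zero divisor and X (N+1) is invertible, the top coefficient of a
-- vanishing expansion is divisible by every power of q, hence zero; induct on k.
expansion-unique : ∀ k c → (∀ N → expansion c k (suc N) ≈ᶠ ι []) → ∀ j → j ≤ k → c j ≈ᶠ ι []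
expansion-unique zero c vanishes zero z≤n =
  *ι-cancel (c 0) (constantTermOne-⊗ {oneP} {X 1 ^P 1} (constantTermOne ≡.refl) (constantTermOne-^P 1 (constantTermOne-X 0)))
    (≈ᶠ-trans (≈ᶠ-sym (+ᶠ-identityˡ (c 0 *ᶠ ι (oneP ⊗ X 1 ^P 1)))) (vanishes 0))
  where open CommutativeRing fracRing using () renaming (+-identityˡ to +ᶠ-identityˡ)
expansion-unique (suc k) c vanishes j j≤1+k with j ℕ.≟ suc k
... | yes refl = top-vanishes k c vanishes
... | no  j≢1+k = expansion-unique k c (lower-vanishes k c vanishes) j (ℕ.≤-pred (ℕ.≤∧≢⇒< j≤1+k j≢1+k))

expansion-injective : ∀ k c c′ → (∀ N → expansion c k (suc N) ≈ᶠ expansion c′ k (suc N)) → ∀ j → j ≤ k → c j ≈ᶠ c′ j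
expansion-injective k c c′ agree j j≤k =
  x∙y⁻¹≈ε⇒x≈y (c j) (c′ j) (expansion-unique k (λ j → c j -ᶠ c′ j) difference-vanishes j j≤k)
  where
  open CommutativeRing fracRing using () renaming (_-_ to _-ᶠ_)
  open RingProperties (CommutativeRing.ring fracRing) using (x∙y⁻¹≈ε⇒x≈y; x≈y⇒x∙y⁻¹≈ε)
  difference-vanishes : ∀ N → expansion (λ j → c j -ᶠ c′ j) k (suc N) ≈ᶠ ι []
  difference-vanishes N = begin
    ∑ (suc k) (λ j → (c j -ᶠ c′ j) *ᶠ M j)               ≈⟨ ∑-cong (suc k) (λ j _ → distribute (c j) (c′ j) (M j)) ⟩
    ∑ (suc k) (λ j → c j *ᶠ M j -ᶠ c′ j *ᶠ M j)          ≈⟨ ∑-distrib-+ (suc k) (λ j → c j *ᶠ M j) (λ j → -ᶠ (c′ j *ᶠ M j)) ⟩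
    expansion c k (suc N) +ᶠ ∑ (suc k) (λ j → -ᶠ (c′ j *ᶠ M j))
      ≈⟨ +ᶠ-congˡ (expansion c k (suc N)) (∑-distrib-neg (suc k) (λ j → c′ j *ᶠ M j)) ⟩
    expansion c k (suc N) -ᶠ expansion c′ k (suc N)       ≈⟨ x≈y⇒x∙y⁻¹≈ε (agree N) ⟩
    ι []                                                  ∎
    where
    open ≈ᶠ-Reasoning
    M = basis (suc N) k
    distribute : ∀ a b x → (a +ᶠ -ᶠ b) *ᶠ x ≈ᶠ a *ᶠ x +ᶠ -ᶠ (b *ᶠ x)
    distribute = solve-∀ fracACR

open Matrices fracRing

Aᶠ : Matrix
Aᶠ k m = ι (aEntry k m)

Bᶠ : (ℕ → ℕ → Poly) → Matrix
Bᶠ P k m = if m ≤ᵇ k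
  then fraction (scale (sign (k ∸ m)) (qfact m ⊗ P k (k ∸ m))) (qfact (suc k)) (constantTermOne-qfact (suc k))
  else ι []

Aᶠ-lower : LowerTriangular Aᶠ
Aᶠ-lower k<m = ι-cong (≋-reflexive (aEntry-above k<m))

Bᶠ-lower : ∀ P → LowerTriangular (Bᶠ P)
Bᶠ-lower P k<m rewrite ≤ᵇ-false k<m = ≈ᶠ-refl

toFrac-if : ∀ b x y → toFrac (if b then x else y) ≡ (if b then toFrac x else toFrac y)
toFrac-if true  x y = refl
toFrac-if false x y = refl

toFrac-× : ∀ n M N k m {M′ N′ : ℕ → ℕ → Frac} → (∀ i j → toFrac (M i j) ≡ M′ i j) → (∀ i j → toFrac (N i j) ≡ N′ i j) →
           toFrac ((M ×[ n ] N) k m) ≡ matMul n M′ N′ k m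
toFrac-× n M N k m M≡ N≡ = toFrac-∑ (suc n) (λ j → ≡.cong₂ _⊗F_ (M≡ k j) (N≡ j m))

toFrac-B : ∀ P k m → toFrac (Bᶠ P k m) ≡ B P k m
toFrac-B P k m = toFrac-if (m ≤ᵇ k) _ _

toFrac-I : ∀ k m → toFrac (I k m) ≡ δ k m
toFrac-I k m = toFrac-if (k ℕ.≡ᵇ m) _ _

halfX : ℕ → ℕ → Fraction
halfX n j = fraction (X n ^P suc j) (qint 2) (constantTermOne-qint 1)

faulhaberRHSᶠ : (ℕ → ℕ → Poly) → ℕ → ℕ → Fraction
faulhaberRHSᶠ P m n = ∑ (suc m) (λ j →
  fraction (scale (sign (m ∸ j)) (qfact j)) (qfact (suc m)) (constantTermOne-qfact (suc m))
  *ᶠ ι (P m (m ∸ j) ⊗ qP ^P ((m ∸ j) ℕ.* n)) *ᶠ halfX n j)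

powerSum≈faulhaberRHSᶠ : ∀ P → IsQFaulhaber P → ∀ m N → powerSum m (suc N) ≈ᶠ faulhaberRHSᶠ P m (suc N)
powerSum≈faulhaberRHSᶠ P hyp m N = ≃F⇒≈ᶠ (≡.subst₂ _≃F_ (≡.sym (toFrac-powerSum m (suc N))) (≡.sym (toFrac-∑ (suc m) (λ j → refl)))
                                          (hyp m (suc N) (s≤s z≤n)))

faulhaberTerm : (ℕ → ℕ → Poly) → ℕ → ℕ → ℕ → Fraction
faulhaberTerm P N m j = Bᶠ P m j *ᶠ ι (qP ^P ((m ∸ j) ℕ.* N)) *ᶠ halfX N j

Bᶠ-entry : ∀ P {m j} → j ≤ m →
  Bᶠ P m j ≡ fraction (scale (sign (m ∸ j)) (qfact j ⊗ P m (m ∸ j))) (qfact (suc m)) (constantTermOne-qfact (suc m))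
Bᶠ-entry P j≤m rewrite ≤ᵇ-true j≤m = refl

faulhaberRHSᶠ-via-B : ∀ P m N → faulhaberRHSᶠ P m N ≈ᶠ ∑ (suc m) (faulhaberTerm P N m)
faulhaberRHSᶠ-via-B P m N = ∑-cong (suc m) λ j j<1+m →
  ≈ᶠ-trans (*ᶠ-congʳ (halfX N j) (move-P j))
           (≈ᶠ-reflexive (≡.cong (λ b → b *ᶠ Q j *ᶠ halfX N j) (≡.sym (Bᶠ-entry P (ℕ.≤-pred j<1+m)))))
  where
  ct = constantTermOne-qfact (suc m)
  Q : ℕ → Fraction
  Q j = ι (qP ^P ((m ∸ j) ℕ.* N))
  move-P : ∀ j → fraction (scale (sign (m ∸ j)) (qfact j)) (qfact (suc m)) ct *ᶠ ι (P m (m ∸ j) ⊗ qP ^P ((m ∸ j) ℕ.* N))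
                 ≈ᶠ fraction (scale (sign (m ∸ j)) (qfact j ⊗ P m (m ∸ j))) (qfact (suc m)) ct *ᶠ Q j
  move-P j = cross (⊗-congʳ (qfact (suc m) ⊗ oneP)
    (≋-trans (≋-sym (⊗-assoc (scale (sign (m ∸ j)) (qfact j)) (P m (m ∸ j)) _))
             (⊗-congʳ (qP ^P ((m ∸ j) ℕ.* N)) (⊗-scaleˡ (sign (m ∸ j)) (qfact j) (P m (m ∸ j))))))

faulhaberTerm-above : ∀ P N {m j} → m < j → faulhaberTerm P N m j ≈ᶠ ι []
faulhaberTerm-above P N {m} {j} m<j = ≈ᶠ-trans (*ᶠ-congʳ (halfX N j) (*ᶠ-congʳ (ι (qP ^P ((m ∸ j) ℕ.* N))) (Bᶠ-lower P m<j)))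
                                   (annihilate (ι (qP ^P ((m ∸ j) ℕ.* N))) (halfX N j))
  where
  annihilate : ∀ x y → ι [] *ᶠ x *ᶠ y ≈ᶠ ι []
  annihilate = solve-∀ fracACR

powerSum-expansion : ∀ P → IsQFaulhaber P → ∀ {k m} N → m ≤ k → powerSum m (suc N) ≈ᶠ ∑ (suc k) (faulhaberTerm P (suc N) m)
powerSum-expansion P hyp {k} {m} N m≤k =
  ≈ᶠ-trans (powerSum≈faulhaberRHSᶠ P hyp m N)
    (≈ᶠ-trans (faulhaberRHSᶠ-via-B P m (suc N))
      (≈ᶠ-sym (∑-extend (faulhaberTerm P (suc N) m) (s≤s m≤k) λ j m<j _ → faulhaberTerm-above P (suc N) m<j)))

-- The q-exponents (k - m) N and (m - j) N add up because j ≤ m ≤ k.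
product-term : ∀ P N {k m} j → m ≤ k → ι (qint 2) *ᶠ (weight N k m *ᶠ faulhaberTerm P N m j) ≈ᶠ (Aᶠ k m *ᶠ Bᶠ P m j) *ᶠ basis N k j
product-term P N {k} {m} j m≤k with j ℕ.≤? m
... | no  j≰m = ≈ᶠ-trans (*ᶠ-congˡ (ι (qint 2)) (*ᶠ-congˡ (weight N k m) (faulhaberTerm-above P N (ℕ.≰⇒> j≰m))))
                (≈ᶠ-trans (vanish₁ (ι (qint 2)) (weight N k m))
                  (≈ᶠ-sym (≈ᶠ-trans (*ᶠ-congʳ (basis N k j) (*ᶠ-congˡ (Aᶠ k m) (Bᶠ-lower P (ℕ.≰⇒> j≰m))))
                                    (vanish₂ (Aᶠ k m) (basis N k j)))))
  where
  vanish₁ : ∀ x y → x *ᶠ (y *ᶠ ι []) ≈ᶠ ι []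
  vanish₁ = solve-∀ fracACR
  vanish₂ : ∀ x y → (x *ᶠ ι []) *ᶠ y ≈ᶠ ι []
  vanish₂ = solve-∀ fracACR
... | yes j≤m = begin
  ι (qint 2) *ᶠ (ι (aEntry k m ⊗ Q₁) *ᶠ ((Bᶠ P m j *ᶠ ι Q₂) *ᶠ halfX N j))
    ≈⟨ *ᶠ-congˡ (ι (qint 2)) (*ᶠ-congʳ ((Bᶠ P m j *ᶠ ι Q₂) *ᶠ halfX N j) (ι-* (aEntry k m) Q₁)) ⟩
  ι (qint 2) *ᶠ ((Aᶠ k m *ᶠ ι Q₁) *ᶠ ((Bᶠ P m j *ᶠ ι Q₂) *ᶠ halfX N j))
    ≈⟨ regroup (ι (qint 2)) (Aᶠ k m) (Bᶠ P m j) (ι Q₁) (ι Q₂) (halfX N j) ⟩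
  (Aᶠ k m *ᶠ Bᶠ P m j) *ᶠ ((ι Q₁ *ᶠ ι Q₂) *ᶠ (ι (qint 2) *ᶠ halfX N j))
    ≈⟨ *ᶠ-congˡ (Aᶠ k m *ᶠ Bᶠ P m j) (*ᶠ-cong (≈ᶠ-trans (≈ᶠ-sym (ι-* Q₁ Q₂)) (ι-cong exponents-add)) [2]·halfX) ⟩
  (Aᶠ k m *ᶠ Bᶠ P m j) *ᶠ (ι (qP ^P ((k ∸ j) ℕ.* N)) *ᶠ ι (X N ^P suc j))
    ≈⟨ *ᶠ-congˡ (Aᶠ k m *ᶠ Bᶠ P m j) (ι-* (qP ^P ((k ∸ j) ℕ.* N)) (X N ^P suc j)) ⟨
  (Aᶠ k m *ᶠ Bᶠ P m j) *ᶠ basis N k j ∎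
  where
  open ≈ᶠ-Reasoning
  Q₁ = qP ^P ((k ∸ m) ℕ.* N)
  Q₂ = qP ^P ((m ∸ j) ℕ.* N)
  regroup : ∀ i A B Q₁ Q₂ Xh → i *ᶠ ((A *ᶠ Q₁) *ᶠ ((B *ᶠ Q₂) *ᶠ Xh)) ≈ᶠ (A *ᶠ B) *ᶠ ((Q₁ *ᶠ Q₂) *ᶠ (i *ᶠ Xh))
  regroup = solve-∀ fracACR
  [2]·halfX : ι (qint 2) *ᶠ halfX N j ≈ᶠ ι (X N ^P suc j)
  [2]·halfX = cross (swap (qint 2) (X N ^P suc j))
    where
    swap : ∀ a b → (a ⊗ b) ⊗ oneP ≋ b ⊗ (oneP ⊗ a)
    swap = solve-∀ polyACR
  exponents-add : Q₁ ⊗ Q₂ ≋ qP ^P ((k ∸ j) ℕ.* N)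
  exponents-add = ≋-trans (≋-sym (^P-homo-⊗ qP ((k ∸ m) ℕ.* N) ((m ∸ j) ℕ.* N)))
    (≋-reflexive (≡.cong (qP ^P_) (≡.trans (≡.sym (ℕ.*-distribʳ-+ N (k ∸ m) (m ∸ j))) (≡.cong (ℕ._* N) ∸-telescope))))
    where
    ∸-telescope : (k ∸ m) ℕ.+ (m ∸ j) ≡ k ∸ j
    ∸-telescope = ≡.sym (≡.trans (≡.cong (_∸ j) (≡.sym (ℕ.m∸n+n≡m m≤k))) (ℕ.+-∸-assoc (k ∸ m) j≤m))

power-expansion : ∀ P → IsQFaulhaber P → ∀ n {k} N → k ≤ n →
                  ι (X (suc N) ^P suc k) ≈ᶠ expansion (λ j → (Aᶠ ×[ n ] Bᶠ P) k j) k (suc N)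
power-expansion P hyp n {k} N k≤n = begin
  ι (X N′ ^P suc k)
    ≈⟨ power-sum-inversion N′ k ⟨
  ι (qint 2) *ᶠ ∑ (suc k) (λ m → weight N′ k m *ᶠ powerSum m N′)
    ≈⟨ *ᶠ-congˡ (ι (qint 2)) (∑-cong (suc k) λ m m<1+k → *ᶠ-congˡ (weight N′ k m) (powerSum-expansion P hyp N (ℕ.≤-pred m<1+k))) ⟩
  ι (qint 2) *ᶠ ∑ (suc k) (λ m → weight N′ k m *ᶠ ∑ (suc k) (faulhaberTerm P N′ m))
    ≈⟨ *-distribˡ-∑ (suc k) (ι (qint 2)) (λ m → weight N′ k m *ᶠ ∑ (suc k) (faulhaberTerm P N′ m)) ⟩
  ∑ (suc k) (λ m → ι (qint 2) *ᶠ (weight N′ k m *ᶠ ∑ (suc k) (faulhaberTerm P N′ m)))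
    ≈⟨ ∑-cong (suc k) (λ m m<1+k → row m (ℕ.≤-pred m<1+k)) ⟩
  ∑ (suc k) (λ m → ∑ (suc k) (λ j → (Aᶠ k m *ᶠ Bᶠ P m j) *ᶠ basis N′ k j))
    ≈⟨ ∑-comm (suc k) (suc k) (λ m j → (Aᶠ k m *ᶠ Bᶠ P m j) *ᶠ basis N′ k j) ⟩
  ∑ (suc k) (λ j → ∑ (suc k) (λ m → (Aᶠ k m *ᶠ Bᶠ P m j) *ᶠ basis N′ k j))
    ≈⟨ ∑-cong (suc k) (λ j _ → *-distribʳ-∑ (suc k) (basis N′ k j) (λ m → Aᶠ k m *ᶠ Bᶠ P m j)) ⟨
  ∑ (suc k) (λ j → ∑ (suc k) (λ m → Aᶠ k m *ᶠ Bᶠ P m j) *ᶠ basis N′ k j)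
    ≈⟨ ∑-cong (suc k) (λ j _ → *ᶠ-congʳ (basis N′ k j) (∑-extend (λ m → Aᶠ k m *ᶠ Bᶠ P m j) (s≤s k≤n)
                                   λ m k<m _ → ≈ᶠ-trans (*ᶠ-congʳ (Bᶠ P m j) (Aᶠ-lower k<m)) (zeroˡ (Bᶠ P m j)))) ⟨
  ∑ (suc k) (λ j → (Aᶠ ×[ n ] Bᶠ P) k j *ᶠ basis N′ k j) ∎
  where
  open ≈ᶠ-Reasoning
  open CommutativeRing fracRing using (zeroˡ)
  N′ = suc N
  row : ∀ m → m ≤ k → ι (qint 2) *ᶠ (weight N′ k m *ᶠ ∑ (suc k) (faulhaberTerm P N′ m))
                    ≈ᶠ ∑ (suc k) (λ j → (Aᶠ k m *ᶠ Bᶠ P m j) *ᶠ basis N′ k j)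
  row m m≤k = begin
    ι (qint 2) *ᶠ (weight N′ k m *ᶠ ∑ (suc k) (faulhaberTerm P N′ m))
      ≈⟨ *ᶠ-congˡ (ι (qint 2)) (*-distribˡ-∑ (suc k) (weight N′ k m) (faulhaberTerm P N′ m)) ⟩
    ι (qint 2) *ᶠ ∑ (suc k) (λ j → weight N′ k m *ᶠ faulhaberTerm P N′ m j)
      ≈⟨ *-distribˡ-∑ (suc k) (ι (qint 2)) (λ j → weight N′ k m *ᶠ faulhaberTerm P N′ m j) ⟩
    ∑ (suc k) (λ j → ι (qint 2) *ᶠ (weight N′ k m *ᶠ faulhaberTerm P N′ m j))
      ≈⟨ ∑-cong (suc k) (λ j _ → product-term P N′ j m≤k) ⟩
    ∑ (suc k) (λ j → (Aᶠ k m *ᶠ Bᶠ P m j) *ᶠ basis N′ k j) ∎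

expansion-I : ∀ k N → expansion (I k) k N ≈ᶠ ι (X N ^P suc k)
expansion-I k N = begin
  ∑ (suc k) (λ j → I k j *ᶠ basis N k j)
    ≈⟨ ∑-single (suc k) k (λ j → I k j *ᶠ basis N k j) ℕ.≤-refl
         (λ j _ j≢k → ≈ᶠ-trans (*ᶠ-congʳ (basis N k j) (I-off-diagonal (j≢k ∘ ≡.sym))) (zeroˡ (basis N k j))) ⟩
  I k k *ᶠ basis N k k
    ≈⟨ *ᶠ-cong (I-diagonal k) (ι-cong (≋-trans (⊗-congʳ (X N ^P suc k) (≋-reflexive (≡.cong (λ d → qP ^P (d ℕ.* N)) (ℕ.n∸n≡0 k))))
                                              (⊗-identityˡ (X N ^P suc k)))) ⟩
  ι oneP *ᶠ ι (X N ^P suc k)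
    ≈⟨ *-identityˡ (ι (X N ^P suc k)) ⟩
  ι (X N ^P suc k) ∎
  where
  open ≈ᶠ-Reasoning
  open CommutativeRing fracRing using (zeroˡ; *-identityˡ)

AB≈I : ∀ P → IsQFaulhaber P → ∀ n → (Aᶠ ×[ n ] Bᶠ P) ≈[ n ] I
AB≈I P hyp n {k} {m} k≤n m≤n with m ℕ.≤? k
... | yes m≤k = expansion-injective k (λ j → (Aᶠ ×[ n ] Bᶠ P) k j) (I k)
                  (λ N → ≈ᶠ-trans (≈ᶠ-sym (power-expansion P hyp n N k≤n)) (≈ᶠ-sym (expansion-I k (suc N)))) m m≤k
... | no  m≰k = ≈ᶠ-trans (×-lower n Aᶠ-lower (Bᶠ-lower P) (ℕ.≰⇒> m≰k))
                         (≈ᶠ-sym (I-off-diagonal (ℕ.<⇒≢ (ℕ.≰⇒> m≰k))))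

theorem2 : (P : ℕ → ℕ → Poly) → IsQFaulhaber P →
    (n : ℕ) → (k m : ℕ) → k ≤ n → m ≤ n →
      (matMul n A (B P) k m ≃F δ k m) × (matMul n (B P) A k m ≃F δ k m)
theorem2 P hyp n k m k≤n m≤n =
    in-Frac {Aᶠ} {Bᶠ P} (AB≈I P hyp n k≤n m≤n) (λ _ _ → refl) (toFrac-B P)
  , in-Frac {Bᶠ P} {Aᶠ} (right-inverse⇒left-inverse n Aᶠ-lower (Bᶠ-lower P) (AB≈I P hyp n) k≤n m≤n) (toFrac-B P) (λ _ _ → refl)
  where
  in-Frac : ∀ {M N M′ N′} → (M ×[ n ] N) k m ≈ᶠ I k m → (∀ i j → toFrac (M i j) ≡ M′ i j) →
            (∀ i j → toFrac (N i j) ≡ N′ i j) → matMul n M′ N′ k m ≃F δ k m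
  in-Frac {M} {N} MN≈I M≡ N≡ = ≡.subst₂ _≃F_ (toFrac-× n M N k m M≡ N≡) (toFrac-I k m) (≈ᶠ⇒≃F MN≈I)
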